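{- Let $n\ge 27$. For each integer $a$ with $3\le a\le \lfloor (n-15)/3\rfloor$ and $n-a\equiv 0\pmod 2$, every integer in the interval $\left[\binom{a-1}{2}+1,\ \binom{a}{2}\right]$ is an eigenvalue of $\mathrm{Cay}(S_n,T_n)$.
   Context: $S_n$ is the symmetric group on $\{1,\dots,n\}$ and $T_n\subseteq S_n$ is the set of all transpositions. The transposition graph $\mathrm{Cay}(S_n,T_n)$ is the Cayley graph with vertex set $S_n$ in which $f,g\in S_n$ are adjacent iff $fg^{ -1}\in T_n$. Its eigenvalues are the eigenvalues of its adjacency matrix. -}

module Defs where

open import Data.Nat using (ℕ; zero; suc)
open import Data.Fin using (Fin; _≟_; _<_)
open import Data.Fin.Properties using (_<?_)
open import Data.Vec using (Vec; []; _∷_; lookup; tabulate; toList)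
open import Data.Vec.Properties using (≡-dec)
open import Data.List using (List; []; _∷_; map; concatMap; filter; foldr; allFin; cartesianProduct)
open import Data.List.Relation.Unary.Any using (Any; any?)
open import Data.List.Relation.Unary.Unique.Propositional using (Unique)
import Data.List.Relation.Unary.Unique.DecPropositional as UD
open import Data.List.Membership.Propositional using (_∈_)
open import Data.Integer using (ℤ; _*_; _+_) renaming (0ℤ to 0z)
open import Data.Product using (_×_; _,_; proj₁; proj₂; ∃)
open import Relation.Nullary using (¬_; Dec; does; yes; no)
open import Relation.Nullary.Decidable using (_×-dec_)
open import Relation.Binary.PropositionalEquality using (_≡_)
open import Data.Bool using (if_then_else_)

-- A map {0..n-1} → {0..n-1} in one-line notation: the vector (σ(0),…,σ(n-1)).
Word : ℕ → Set
Word n = Vec (Fin n) n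

allVecs : (m k : ℕ) → List (Vec (Fin k) m)
allVecs zero    k = [] ∷ []
allVecs (suc m) k = concatMap (λ x → map (x ∷_) (allVecs m k)) (allFin k)

IsPerm : ∀ {n} → Word n → Set
IsPerm σ = Unique (toList σ)

isPerm? : ∀ {n} (σ : Word n) → Dec (IsPerm σ)
isPerm? σ = UD.unique? _≟_ (toList σ)

-- The symmetric group S_n, listed (each element exactly once)
Sym : (n : ℕ) → List (Word n)
Sym n = filter isPerm? (allVecs n n)

_∘ₚ_ : ∀ {n} → Word n → Word n → Word n
f ∘ₚ g = tabulate (λ x → lookup f (lookup g x))

swapFin : ∀ {n} → Fin n → Fin n → Fin n → Fin n
swapFin i j k = if does (k ≟ i) then j else (if does (k ≟ j) then i else k)

transposition : ∀ {n} → Fin n → Fin n → Word n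
transposition i j = tabulate (swapFin i j)

IsTranspositionPair : ∀ {n} → Fin n × Fin n → Set
IsTranspositionPair (i , j) = i < j

-- Adjacency in Cay(S_n, T_n): f ~ g iff f g⁻¹ ∈ T_n, i.e. f = t ∘ g for some t ∈ T_n
Adj : ∀ {n} → Word n → Word n → Set
Adj {n} f g = Any (λ p → IsTranspositionPair p × (f ≡ transposition (proj₁ p) (proj₂ p) ∘ₚ g))
                  (cartesianProduct (allFin n) (allFin n))

adj? : ∀ {n} (f g : Word n) → Dec (Adj f g)
adj? {n} f g = any? (λ p → (proj₁ p <? proj₂ p) ×-dec ≡-dec _≟_ f (transposition (proj₁ p) (proj₂ p) ∘ₚ g))
                    (cartesianProduct (allFin n) (allFin n))

sumℤ : List ℤ → ℤ
sumℤ = foldr _+_ 0z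

adjAct : ∀ {n} → (Word n → ℤ) → Word n → ℤ
adjAct {n} v f = sumℤ (map v (filter (adj? f) (Sym n)))

IsEigenvalue : ℕ → ℤ → Set
IsEigenvalue n λ' = ∃ λ (v : Word n → ℤ) →
  Any (λ g → ¬ (v g ≡ 0z)) (Sym n) ×
  (∀ f → f ∈ Sym n → adjAct v f ≡ λ' * v f)

{-# OPTIONS --safe #-}
module Submission where

-- Let c₁ ≤ ⋯ ≤ c_r be the column lengths of a partition of n and split a list of
-- n integers into consecutive blocks of these lengths.  The product of the Vandermonde
-- determinants of the blocks (a Specht polynomial), evaluated at the positions g⁻¹(0), …,
-- g⁻¹(n−1), is a function on S_n.  Summing it over all transpositions t of positions, a swap
-- inside a block of length c only changes the sign of that block's determinant, contributing
-- −C(c,2), while the swaps between a block of length c and a later (longer) block contribute c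
-- times the polynomial, by Lagrange interpolation.  Hence the function is an eigenvector of
-- Cay(S_n, T_n) with eigenvalue the content sum Σ_{i<j} c_i − Σ_i C(c_i,2) of the partition.
-- For the partition with Frobenius coordinates (α | β) the content sum is
-- Σ C(α_i+1,2) − Σ C(β_i+1,2), and explicit choices of two or three hooks realise
-- C(a,2) − k for every 0 ≤ k ≤ a − 2 with size n = 3a + 16 + 2t.

open import Defs
open import Data.Integer using (ℤ; +_; 0ℤ; 1ℤ)
import Data.Integer.Properties as ℤ
open import Data.List using (List; []; _∷_; _++_; length)
open import Data.List.Properties using (++-assoc; length-++)
open import Data.List.Relation.Unary.All using (All; []; _∷_)
open import Data.List.Relation.Unary.AllPairs using (AllPairs; []; _∷_)
open import Data.List.Relation.Unary.Unique.Propositional using (Unique)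
open import Data.Nat as ℕ using (ℕ; zero; suc)
import Data.Nat.Properties as ℕ
open import Data.Nat.ListAction using (sum)
open import Data.Product using (Σ-syntax; ∃-syntax; _×_; _,_; proj₁; proj₂; uncurry)
open import Data.Sum using (inj₁; inj₂)
open import Relation.Binary.PropositionalEquality
  using (_≡_; _≢_; refl; sym; trans; cong; cong₂; subst; module ≡-Reasoning; setoid)
open import Relation.Nullary using (yes; no)

choose2 : ℕ → ℕ
choose2 zero    = 0
choose2 (suc n) = n ℕ.+ choose2 n

-- A partition is given by its column lengths in ascending order; then column i meets each
-- later column in c_i rows, so rowPairs counts the pairs of cells in a common row.
rowPairs : List ℕ → ℕ
rowPairs []       = 0
rowPairs (c ∷ cs) = c ℕ.* length cs ℕ.+ rowPairs cs

columnPairs : List ℕ → ℕ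
columnPairs []       = 0
columnPairs (c ∷ cs) = choose2 c ℕ.+ columnPairs cs

module SwapSums {A : Set} where

  open import Data.Integer using (_+_; _*_; -_)
  open import Data.Integer.Tactic.RingSolver using (solve-∀)

  ∑pick : List A → (List A → A → List A → ℤ) → ℤ
  ∑pick []       K = 0ℤ
  ∑pick (x ∷ xs) K = K [] x xs + ∑pick xs (λ p z s → K (x ∷ p) z s)

  ∑pick-cong : ∀ xs {K L : List A → A → List A → ℤ} →
    (∀ p z s → p ++ z ∷ s ≡ xs → K p z s ≡ L p z s) → ∑pick xs K ≡ ∑pick xs L
  ∑pick-cong []       K≗L = refl
  ∑pick-cong (x ∷ xs) K≗L =
    cong₂ _+_ (K≗L [] x xs refl) (∑pick-cong xs (λ p z s eq → K≗L (x ∷ p) z s (cong (x ∷_) eq)))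

  ∑pick-+ : ∀ xs K L →
    ∑pick xs (λ p z s → K p z s + L p z s) ≡ ∑pick xs K + ∑pick xs L
  ∑pick-+ []       K L = refl
  ∑pick-+ (x ∷ xs) K L = trans
    (cong (_+_ (K [] x xs + L [] x xs)) (∑pick-+ xs (λ p → K (x ∷ p)) (λ p → L (x ∷ p))))
    (interchange (K [] x xs) (L [] x xs) _ _)
    where
    interchange : ∀ a b c d → a + b + (c + d) ≡ a + c + (b + d)
    interchange = solve-∀

  ∑pick-*ˡ : ∀ xs c K → ∑pick xs (λ p z s → c * K p z s) ≡ c * ∑pick xs K
  ∑pick-*ˡ []       c K = sym (ℤ.*-zeroʳ c)
  ∑pick-*ˡ (x ∷ xs) c K = trans
    (cong (_+_ (c * K [] x xs)) (∑pick-*ˡ xs c (λ p → K (x ∷ p))))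
    (sym (ℤ.*-distribˡ-+ c (K [] x xs) _))

  ∑pick-*ʳ : ∀ xs c K → ∑pick xs (λ p z s → K p z s * c) ≡ ∑pick xs K * c
  ∑pick-*ʳ xs c K = begin
    ∑pick xs (λ p z s → K p z s * c) ≡⟨ ∑pick-cong xs (λ p z s _ → ℤ.*-comm (K p z s) c) ⟩
    ∑pick xs (λ p z s → c * K p z s) ≡⟨ ∑pick-*ˡ xs c K ⟩
    c * ∑pick xs K                   ≡⟨ ℤ.*-comm c _ ⟩
    ∑pick xs K * c                   ∎
    where open ≡-Reasoning

  ∑pick-neg : ∀ xs K → ∑pick xs (λ p z s → - K p z s) ≡ - ∑pick xs K
  ∑pick-neg []       K = refl
  ∑pick-neg (x ∷ xs) K = trans
    (cong (_+_ (- K [] x xs)) (∑pick-neg xs (λ p → K (x ∷ p))))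
    (sym (ℤ.neg-distrib-+ (K [] x xs) _))

  ∑pick-const : ∀ xs c → ∑pick xs (λ _ _ _ → c) ≡ + length xs * c
  ∑pick-const []       c = refl
  ∑pick-const (x ∷ xs) c = trans (cong (_+_ c) (∑pick-const xs c)) (count (+ length xs) c)
    where
    count : ∀ n c → c + n * c ≡ (1ℤ + n) * c
    count = solve-∀

  ∑pick-++ : ∀ xs ys K →
    ∑pick (xs ++ ys) K ≡ ∑pick xs (λ p z s → K p z (s ++ ys)) + ∑pick ys (λ p z s → K (xs ++ p) z s)
  ∑pick-++ []       ys K = sym (ℤ.+-identityˡ _)
  ∑pick-++ (x ∷ xs) ys K = trans
    (cong (_+_ (K [] x (xs ++ ys))) (∑pick-++ xs ys (λ p → K (x ∷ p))))
    (sym (ℤ.+-assoc (K [] x (xs ++ ys)) _ _))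

  ∑swap : List A → (List A → ℤ) → ℤ
  ∑swap []       H = 0ℤ
  ∑swap (y ∷ ys) H = ∑pick ys (λ p z s → H (z ∷ p ++ y ∷ s)) + ∑swap ys (λ l → H (y ∷ l))

  length-exchange : ∀ (p s : List A) y z → length (p ++ y ∷ s) ≡ length (p ++ z ∷ s)
  length-exchange []      s y z = refl
  length-exchange (x ∷ p) s y z = cong suc (length-exchange p s y z)

  ∑swap-cong : ∀ xs {H H′ : List A → ℤ} →
    (∀ l → length l ≡ length xs → H l ≡ H′ l) → ∑swap xs H ≡ ∑swap xs H′
  ∑swap-cong []       H≗H′ = refl
  ∑swap-cong (y ∷ ys) H≗H′ = cong₂ _+_
    (∑pick-cong ys (λ p z s eq →
      H≗H′ (z ∷ p ++ y ∷ s) (cong suc (trans (length-exchange p s y z) (cong length eq)))))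
    (∑swap-cong ys (λ l eq → H≗H′ (y ∷ l) (cong suc eq)))

  ∑swap-*ˡ : ∀ xs c H → ∑swap xs (λ l → c * H l) ≡ c * ∑swap xs H
  ∑swap-*ˡ []       c H = sym (ℤ.*-zeroʳ c)
  ∑swap-*ˡ (y ∷ ys) c H = trans
    (cong₂ _+_ (∑pick-*ˡ ys c (λ p z s → H (z ∷ p ++ y ∷ s))) (∑swap-*ˡ ys c (λ l → H (y ∷ l))))
    (sym (ℤ.*-distribˡ-+ c _ _))

  ∑exchange : List A → List A → (List A → List A → ℤ) → ℤ
  ∑exchange xs zs F = ∑pick xs (λ p x s → ∑pick zs (λ p′ z s′ → F (p ++ z ∷ s) (p′ ++ x ∷ s′)))

  ∑exchange-cong : ∀ xs zs {F G : List A → List A → ℤ} →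
    (∀ l l′ → length l ≡ length xs → length l′ ≡ length zs → F l l′ ≡ G l l′) →
    ∑exchange xs zs F ≡ ∑exchange xs zs G
  ∑exchange-cong xs zs F≗G = ∑pick-cong xs (λ p x s eq → ∑pick-cong zs (λ p′ z s′ eq′ →
    F≗G _ _ (trans (length-exchange p s z x) (cong length eq)) (trans (length-exchange p′ s′ x z) (cong length eq′))))

  ∑exchange-*ˡ : ∀ xs zs c F → ∑exchange xs zs (λ l l′ → c * F l l′) ≡ c * ∑exchange xs zs F
  ∑exchange-*ˡ xs zs c F = trans
    (∑pick-cong xs (λ p x s _ → ∑pick-*ˡ zs c (λ p′ z s′ → F (p ++ z ∷ s) (p′ ++ x ∷ s′))))
    (∑pick-*ˡ xs c _)

  ∑exchange-*ʳ : ∀ xs zs c F → ∑exchange xs zs (λ l l′ → F l l′ * c) ≡ ∑exchange xs zs F * c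
  ∑exchange-*ʳ xs zs c F = begin
    ∑exchange xs zs (λ l l′ → F l l′ * c) ≡⟨ ∑exchange-cong xs zs (λ l l′ _ _ → ℤ.*-comm (F l l′) c) ⟩
    ∑exchange xs zs (λ l l′ → c * F l l′) ≡⟨ ∑exchange-*ˡ xs zs c F ⟩
    c * ∑exchange xs zs F                 ≡⟨ ℤ.*-comm c _ ⟩
    ∑exchange xs zs F * c                 ∎
    where open ≡-Reasoning

  ∑exchange-++ʳ : ∀ xs ws us F → ∑exchange xs (ws ++ us) F ≡
    ∑exchange xs ws (λ l l′ → F l (l′ ++ us)) + ∑exchange xs us (λ l l′ → F l (ws ++ l′))
  ∑exchange-++ʳ xs ws us F = trans
    (∑pick-cong xs (λ p x s _ → trans (∑pick-++ ws us (λ p′ z s′ → F (p ++ z ∷ s) (p′ ++ x ∷ s′)))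
      (cong₂ _+_ (∑pick-cong ws (λ p′ z s′ _ → cong (F (p ++ z ∷ s)) (sym (++-assoc p′ (x ∷ s′) us))))
                 (∑pick-cong us (λ p′ z s′ _ → cong (F (p ++ z ∷ s)) (++-assoc ws p′ (x ∷ s′)))))))
    (∑pick-+ xs _ _)

  ∑swap-++ : ∀ xs zs H → ∑swap (xs ++ zs) H ≡
    ∑swap xs (λ l → H (l ++ zs)) + ∑swap zs (λ l → H (xs ++ l)) + ∑exchange xs zs (λ l l′ → H (l ++ l′))
  ∑swap-++ []       zs H = sym (trans (ℤ.+-identityʳ _) (ℤ.+-identityˡ _))
  ∑swap-++ (x ∷ xs) zs H = begin
    ∑pick (xs ++ zs) (λ p z s → H (z ∷ p ++ x ∷ s)) + ∑swap (xs ++ zs) (λ l → H (x ∷ l))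
      ≡⟨ cong₂ _+_ (∑pick-++ xs zs (λ p z s → H (z ∷ p ++ x ∷ s))) (∑swap-++ xs zs (λ l → H (x ∷ l))) ⟩
    (a + b) + (c + d + e)
      ≡⟨ regroup a b c d e ⟩
    a + c + d + (b + e)
      ≡⟨ cong₂ (λ u v → u + c + d + (v + e))
           (∑pick-cong xs (λ p z s _ → cong (λ u → H (z ∷ u)) (sym (++-assoc p (x ∷ s) zs))))
           (∑pick-cong zs (λ p z s _ → cong (λ u → H (z ∷ u)) (++-assoc xs p (x ∷ s)))) ⟩
    ∑swap (x ∷ xs) (λ l → H (l ++ zs)) + ∑swap zs (λ l → H (x ∷ xs ++ l))
      + ∑exchange (x ∷ xs) zs (λ l l′ → H (l ++ l′))
      ∎
    where
    open ≡-Reasoning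
    a = ∑pick xs (λ p z s → H (z ∷ p ++ x ∷ s ++ zs))
    b = ∑pick zs (λ p z s → H (z ∷ (xs ++ p) ++ x ∷ s))
    c = ∑swap xs (λ l → H (x ∷ l ++ zs))
    d = ∑swap zs (λ l → H (x ∷ xs ++ l))
    e = ∑exchange xs zs (λ l l′ → H (x ∷ l ++ l′))
    regroup : ∀ a b c d e → a + b + (c + d + e) ≡ a + c + d + (b + e)
    regroup = solve-∀

module Vandermonde where

  open import Data.Integer using (_+_; _*_; -_; _-_)
  open import Data.Integer.Tactic.RingSolver using (solve-∀)
  open SwapSums

  ∏diff : ℤ → List ℤ → ℤ
  ∏diff x []       = 1ℤ
  ∏diff x (z ∷ zs) = (z - x) * ∏diff x zs

  Δ : List ℤ → ℤ
  Δ []       = 1ℤ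
  Δ (x ∷ xs) = ∏diff x xs * Δ xs

  ∏diff-++ : ∀ x p q → ∏diff x (p ++ q) ≡ ∏diff x p * ∏diff x q
  ∏diff-++ x []      q = sym (ℤ.*-identityˡ (∏diff x q))
  ∏diff-++ x (z ∷ p) q = trans (cong ((z - x) *_) (∏diff-++ x p q)) (sym (ℤ.*-assoc (z - x) _ _))

  ∏diff-exchange : ∀ x p s t z → (z - x) * ∏diff x (p ++ t ∷ s) ≡ (t - x) * ∏diff x (p ++ z ∷ s)
  ∏diff-exchange x p s t z
    rewrite ∏diff-++ x p (t ∷ s) | ∏diff-++ x p (z ∷ s) = swap-factors (z - x) (t - x) (∏diff x p) (∏diff x s)
    where
    swap-factors : ∀ a b c d → a * (c * (b * d)) ≡ b * (c * (a * d))
    swap-factors = solve-∀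

  Δ-swap₀₁ : ∀ x y l → Δ (x ∷ y ∷ l) ≡ - Δ (y ∷ x ∷ l)
  Δ-swap₀₁ x y l = antisymmetric x y (∏diff x l) (∏diff y l) (Δ l)
    where
    antisymmetric : ∀ x y a b d → (y - x) * a * (b * d) ≡ - ((x - y) * b * (a * d))
    antisymmetric = solve-∀

  Δ-swap₀ : ∀ p s y z → Δ (z ∷ p ++ y ∷ s) ≡ - Δ (y ∷ p ++ z ∷ s)
  Δ-swap₀ []      s y z = Δ-swap₀₁ z y s
  Δ-swap₀ (w ∷ p) s y z = begin
    Δ (z ∷ w ∷ p ++ y ∷ s)
      ≡⟨ Δ-swap₀₁ z w (p ++ y ∷ s) ⟩
    - (∏diff w (z ∷ p ++ y ∷ s) * Δ (z ∷ p ++ y ∷ s))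
      ≡⟨ cong (λ u → - (∏diff w (z ∷ p ++ y ∷ s) * u)) (Δ-swap₀ p s y z) ⟩
    - ((z - w) * ∏diff w (p ++ y ∷ s) * - Δ (y ∷ p ++ z ∷ s))
      ≡⟨ cong (λ u → - (u * - Δ (y ∷ p ++ z ∷ s))) (∏diff-exchange w p s y z) ⟩
    - ((y - w) * ∏diff w (p ++ z ∷ s) * - Δ (y ∷ p ++ z ∷ s))
      ≡⟨ double-negation (∏diff w (y ∷ p ++ z ∷ s)) (Δ (y ∷ p ++ z ∷ s)) ⟩
    - - (∏diff w (y ∷ p ++ z ∷ s) * Δ (y ∷ p ++ z ∷ s))
      ≡⟨ cong -_ (Δ-swap₀₁ y w (p ++ z ∷ s)) ⟨
    - Δ (y ∷ w ∷ p ++ z ∷ s) ∎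
    where
    open ≡-Reasoning
    double-negation : ∀ a b → - (a * - b) ≡ - - (a * b)
    double-negation = solve-∀

  Δ-repeat₀₁ : ∀ x l → Δ (x ∷ x ∷ l) ≡ 0ℤ
  Δ-repeat₀₁ x l = vanishes x (∏diff x l) (∏diff x l * Δ l)
    where
    vanishes : ∀ x a b → (x - x) * a * b ≡ 0ℤ
    vanishes = solve-∀

  ∏diff≢0 : ∀ x l → All (x ≢_) l → ∏diff x l ≢ 0ℤ
  ∏diff≢0 x []      _          ()
  ∏diff≢0 x (z ∷ l) (x≢z ∷ px) eq with ℤ.i*j≡0⇒i≡0∨j≡0 (z - x) eq
  ... | inj₁ z-x≡0 = x≢z (sym (ℤ.i-j≡0⇒i≡j z x z-x≡0))
  ... | inj₂ ∏≡0   = ∏diff≢0 x l px ∏≡0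

  Δ≢0 : ∀ l → Unique l → Δ l ≢ 0ℤ
  Δ≢0 []      _          ()
  Δ≢0 (x ∷ l) (px ∷ ul) eq with ℤ.i*j≡0⇒i≡0∨j≡0 (∏diff x l) eq
  ... | inj₁ ∏≡0 = ∏diff≢0 x l px ∏≡0
  ... | inj₂ Δ≡0 = Δ≢0 l ul Δ≡0

  Symmetric : (List ℤ → ℤ) → Set
  Symmetric S = ∀ a m b y z → S (a ++ z ∷ m ++ y ∷ b) ≡ S (a ++ y ∷ m ++ z ∷ b)

  ∏diff-symmetric : ∀ x → Symmetric (∏diff x)
  ∏diff-symmetric x a m b y z
    rewrite ∏diff-++ x a (z ∷ m ++ y ∷ b) | ∏diff-++ x a (y ∷ m ++ z ∷ b)
          | ∏diff-++ x m (y ∷ b) | ∏diff-++ x m (z ∷ b)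
    = commute (∏diff x a) (z - x) (y - x) (∏diff x m) (∏diff x b)
    where
    commute : ∀ a c d e f → a * (c * (e * (d * f))) ≡ a * (d * (e * (c * f)))
    commute = solve-∀

  ∑swap-symmetric-* : ∀ ys (S H : List ℤ → ℤ) → Symmetric S →
    ∑swap ys (λ l → S l * H l) ≡ S ys * ∑swap ys H
  ∑swap-symmetric-* []       S H _     = sym (ℤ.*-zeroʳ (S []))
  ∑swap-symmetric-* (y ∷ ys) S H S-sym = trans
    (cong₂ _+_
      (trans (∑pick-cong ys (λ p z s eq → cong (_* H (z ∷ p ++ y ∷ s))
               (trans (S-sym [] p s y z) (cong (λ u → S (y ∷ u)) eq))))
             (∑pick-*ˡ ys (S (y ∷ ys)) (λ p z s → H (z ∷ p ++ y ∷ s))))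
      (∑swap-symmetric-* ys (λ l → S (y ∷ l)) (λ l → H (y ∷ l)) (λ a → S-sym (y ∷ a))))
    (sym (ℤ.*-distribˡ-+ (S (y ∷ ys)) _ _))

  ∑swap-Δ : ∀ ys → ∑swap ys Δ ≡ - + choose2 (length ys) * Δ ys
  ∑swap-Δ []       = refl
  ∑swap-Δ (y ∷ ys) = begin
    ∑pick ys (λ p z s → Δ (z ∷ p ++ y ∷ s)) + ∑swap ys (λ l → ∏diff y l * Δ l)
      ≡⟨ cong₂ _+_ (∑pick-cong ys (λ p z s eq → trans (Δ-swap₀ p s y z) (cong (λ u → - Δ (y ∷ u)) eq)))
                   (∑swap-symmetric-* ys (∏diff y) Δ (∏diff-symmetric y)) ⟩
    ∑pick ys (λ _ _ _ → - Δ (y ∷ ys)) + ∏diff y ys * ∑swap ys Δ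
      ≡⟨ cong₂ _+_ (∑pick-const ys _) (cong (∏diff y ys *_) (∑swap-Δ ys)) ⟩
    + length ys * - (∏diff y ys * Δ ys) + ∏diff y ys * (- + choose2 (length ys) * Δ ys)
      ≡⟨ collect (+ length ys) (+ choose2 (length ys)) (∏diff y ys) (Δ ys) ⟩
    - (+ length ys + + choose2 (length ys)) * (∏diff y ys * Δ ys)
      ≡⟨ cong (λ u → - u * Δ (y ∷ ys)) (ℤ.pos-+ (length ys) _) ⟨
    - + choose2 (length (y ∷ ys)) * Δ (y ∷ ys)
      ∎
    where
    open ≡-Reasoning
    collect : ∀ n c a d → n * - (a * d) + a * (- c * d) ≡ - (n + c) * (a * d)
    collect = solve-∀

module Polynomials where

  open import Data.Integer using (_+_; _*_; -_; _-_)
  open import Data.Integer.Tactic.RingSolver using (solve-∀)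
  open import Data.List using (map)
  open import Data.List.Properties using (length-map)
  open import Data.Nat using (_≤_; z≤n; s≤s)
  open Vandermonde

  eval : List ℤ → ℤ → ℤ
  eval []       t = 0ℤ
  eval (c ∷ cs) t = c + t * eval cs t

  DegreeBelow : ℕ → (ℤ → ℤ) → Set
  DegreeBelow m f = Σ[ cs ∈ List ℤ ] length cs ≤ m × (∀ t → f t ≡ eval cs t)

  DegreeBelow-resp : ∀ {m f g} → (∀ t → f t ≡ g t) → DegreeBelow m f → DegreeBelow m g
  DegreeBelow-resp f≗g (cs , len , f≗cs) = cs , len , (λ t → trans (sym (f≗g t)) (f≗cs t))

  DegreeBelow-mono : ∀ {m m′ f} → m ≤ m′ → DegreeBelow m f → DegreeBelow m′ f
  DegreeBelow-mono m≤m′ (cs , len , f≗cs) = cs , ℕ.≤-trans len m≤m′ , f≗cs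

  DegreeBelow-const : ∀ {m} c → DegreeBelow (suc m) (λ _ → c)
  DegreeBelow-const c = c ∷ [] , s≤s z≤n , (λ t → sym (constant c t))
    where
    constant : ∀ c t → c + t * 0ℤ ≡ c
    constant = solve-∀

  DegreeBelow-zero : ∀ {f} → DegreeBelow 0 f → ∀ t → f t ≡ 0ℤ
  DegreeBelow-zero ([] , _ , f≗0) = f≗0

  eval-scale : ∀ c cs t → eval (map (c *_) cs) t ≡ c * eval cs t
  eval-scale c []       t = sym (ℤ.*-zeroʳ c)
  eval-scale c (d ∷ cs) t = trans (cong (λ u → c * d + t * u) (eval-scale c cs t)) (factor c d t (eval cs t))
    where
    factor : ∀ c d t e → c * d + t * (c * e) ≡ c * (d + t * e)
    factor = solve-∀

  DegreeBelow-scale : ∀ {m f} c → DegreeBelow m f → DegreeBelow m (λ t → c * f t)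
  DegreeBelow-scale c (cs , len , f≗cs) =
    map (c *_) cs , subst (_≤ _) (sym (length-map (c *_) cs)) len ,
    (λ t → trans (cong (c *_) (f≗cs t)) (sym (eval-scale c cs t)))

  add : List ℤ → List ℤ → List ℤ
  add []       ds       = ds
  add (c ∷ cs) []       = c ∷ cs
  add (c ∷ cs) (d ∷ ds) = c + d ∷ add cs ds

  eval-add : ∀ cs ds t → eval (add cs ds) t ≡ eval cs t + eval ds t
  eval-add []       ds       t = sym (ℤ.+-identityˡ _)
  eval-add (c ∷ cs) []       t = sym (ℤ.+-identityʳ _)
  eval-add (c ∷ cs) (d ∷ ds) t =
    trans (cong (λ u → c + d + t * u) (eval-add cs ds t)) (distribute c d t (eval cs t) (eval ds t))
    where
    distribute : ∀ c d t a b → c + d + t * (a + b) ≡ c + t * a + (d + t * b)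
    distribute = solve-∀

  length-add : ∀ {m} cs ds → length cs ≤ m → length ds ≤ m → length (add cs ds) ≤ m
  length-add []       ds       _           ds≤m        = ds≤m
  length-add (c ∷ cs) []       cs≤m        _           = cs≤m
  length-add (c ∷ cs) (d ∷ ds) (s≤s cs≤m) (s≤s ds≤m) = s≤s (length-add cs ds cs≤m ds≤m)

  DegreeBelow-+ : ∀ {m f g} → DegreeBelow m f → DegreeBelow m g → DegreeBelow m (λ t → f t + g t)
  DegreeBelow-+ (cs , cs≤m , f≗cs) (ds , ds≤m , g≗ds) =
    add cs ds , length-add cs ds cs≤m ds≤m ,
    (λ t → trans (cong₂ _+_ (f≗cs t) (g≗ds t)) (sym (eval-add cs ds t)))

  DegreeBelow-linear : ∀ {m f} a b → DegreeBelow m f → DegreeBelow (suc m) (λ t → (a * t + b) * f t)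
  DegreeBelow-linear {m} {f} a b (cs , len , f≗cs) =
    DegreeBelow-resp (λ t → expand a b t (f t))
      (DegreeBelow-+ (DegreeBelow-scale a (0ℤ ∷ cs , s≤s len , (λ t → times-t t)))
                     (DegreeBelow-mono (ℕ.n≤1+n m) (DegreeBelow-scale b (cs , len , f≗cs))))
    where
    times-t : ∀ t → t * f t ≡ 0ℤ + t * eval cs t
    times-t t = trans (cong (t *_) (f≗cs t)) (sym (ℤ.+-identityˡ _))
    expand : ∀ a b t u → a * (t * u) + b * u ≡ (a * t + b) * u
    expand = solve-∀

  quotient : List ℤ → ℤ → List ℤ
  quotient []           x = []
  quotient (c ∷ [])     x = []
  quotient (c ∷ d ∷ cs) x = eval (d ∷ cs) x ∷ quotient (d ∷ cs) x

  eval-quotient : ∀ cs x t → eval cs t ≡ eval cs x + (t - x) * eval (quotient cs x) t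
  eval-quotient []           x t = sym (empty t x)
    where
    empty : ∀ t x → 0ℤ + (t - x) * 0ℤ ≡ 0ℤ
    empty = solve-∀
  eval-quotient (c ∷ [])     x t = constant c t x
    where
    constant : ∀ c t x → c + t * 0ℤ ≡ c + x * 0ℤ + (t - x) * 0ℤ
    constant = solve-∀
  eval-quotient (c ∷ d ∷ cs) x t =
    trans (cong (λ u → c + t * u) (eval-quotient (d ∷ cs) x t))
          (horner-step c t x (eval (d ∷ cs) x) (eval (quotient (d ∷ cs) x) t))
    where
    horner-step : ∀ c t x e q → c + t * (e + (t - x) * q) ≡ c + x * e + (t - x) * (e + t * q)
    horner-step = solve-∀

  length-quotient : ∀ {m} cs x → length cs ≤ suc m → length (quotient cs x) ≤ m
  length-quotient           []           x _          = z≤n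
  length-quotient           (c ∷ [])     x _          = z≤n
  length-quotient {suc m} (c ∷ d ∷ cs) x (s≤s len) = s≤s (length-quotient (d ∷ cs) x len)

  divide : ∀ {m f} → DegreeBelow (suc m) f → ∀ x →
    Σ[ g ∈ (ℤ → ℤ) ] DegreeBelow m g × (∀ t → f t ≡ f x + (t - x) * g t)
  divide (cs , len , f≗cs) x =
    eval (quotient cs x) , (quotient cs x , length-quotient cs x len , (λ _ → refl)) ,
    (λ t → trans (f≗cs t) (trans (eval-quotient cs x t)
             (cong (λ u → u + (t - x) * eval (quotient cs x) t) (sym (f≗cs x)))))

  ∏diff-degree : ∀ q → DegreeBelow (suc (length q)) (λ t → ∏diff t q)
  ∏diff-degree []      = DegreeBelow-const 1ℤ
  ∏diff-degree (z ∷ q) =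
    DegreeBelow-resp (λ t → cong (_* ∏diff t q) (negate z t)) (DegreeBelow-linear (- 1ℤ) z (∏diff-degree q))
    where
    negate : ∀ z t → - 1ℤ * t + z ≡ z - t
    negate = solve-∀

  Δ-degree : ∀ p q → DegreeBelow (suc (length p ℕ.+ length q)) (λ t → Δ (p ++ t ∷ q))
  Δ-degree []      q =
    DegreeBelow-resp (λ t → ℤ.*-comm (Δ q) (∏diff t q)) (DegreeBelow-scale (Δ q) (∏diff-degree q))
  Δ-degree (y ∷ p) q = DegreeBelow-resp (λ t → trans (factor (∏diff y p) (∏diff y q) y t (Δ (p ++ t ∷ q)))
                                                      (cong (_* Δ (p ++ t ∷ q)) (sym (∏diff-++ y p (t ∷ q)))))
    (DegreeBelow-linear (∏diff y p * ∏diff y q) (- (∏diff y p * ∏diff y q * y)) (Δ-degree p q))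
    where
    factor : ∀ a b y t d → (a * b * t + - (a * b * y)) * d ≡ a * ((t - y) * b) * d
    factor = solve-∀

module Lagrange where

  open import Data.Integer using (_+_; _*_; -_; _-_; ≢-nonZero)
  open import Data.Integer.Tactic.RingSolver using (solve-∀)
  open import Data.Nat using (_≤_)
  open SwapSums
  open Vandermonde
  open Polynomials

  -- Lagrange interpolation at the nodes X without division: for X = p ++ z ∷ q,
  -- Δ (p ++ s ∷ q) / Δ X is the Lagrange basis polynomial of the node z evaluated at s.
  LagrangeIdentity : ℕ → Set
  LagrangeIdentity n = ∀ X → length X ≡ n → ∀ f → DegreeBelow n f → ∀ s →
    ∑pick X (λ p z q → Δ (p ++ s ∷ q) * f z) ≡ Δ X * f s

  lagrange-linear : ∀ {n} → LagrangeIdentity n → ∀ x xs → length xs ≡ n → ∀ g → DegreeBelow n g → ∀ s →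
    ∑pick (x ∷ xs) (λ p z q → Δ (p ++ s ∷ q) * ((z - x) * g z)) ≡ Δ (x ∷ xs) * ((s - x) * g s)
  lagrange-linear IH x xs len g g<n s = begin
    Δ (s ∷ xs) * ((x - x) * g x) + ∑pick xs (λ p z q → Δ (x ∷ p ++ s ∷ q) * ((z - x) * g z))
      ≡⟨ cong (_+_ (Δ (s ∷ xs) * ((x - x) * g x))) (∑pick-cong xs term) ⟩
    Δ (s ∷ xs) * ((x - x) * g x) + ∑pick xs (λ p z q → (s - x) * ∏diff x xs * (Δ (p ++ s ∷ q) * g z))
      ≡⟨ cong (_+_ (Δ (s ∷ xs) * ((x - x) * g x)))
              (trans (∑pick-*ˡ xs ((s - x) * ∏diff x xs) (λ p z q → Δ (p ++ s ∷ q) * g z))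
                     (cong ((s - x) * ∏diff x xs *_) (IH xs len g g<n s))) ⟩
    Δ (s ∷ xs) * ((x - x) * g x) + (s - x) * ∏diff x xs * (Δ xs * g s)
      ≡⟨ collect (Δ (s ∷ xs)) x (g x) s (∏diff x xs) (Δ xs) (g s) ⟩
    Δ (x ∷ xs) * ((s - x) * g s) ∎
    where
    open ≡-Reasoning
    regroup : ∀ a d c g → a * d * (c * g) ≡ c * a * (d * g)
    regroup = solve-∀
    collect : ∀ D x gx s a d gs → D * ((x - x) * gx) + (s - x) * a * (d * gs) ≡ a * d * ((s - x) * gs)
    collect = solve-∀
    term : ∀ p z q → p ++ z ∷ q ≡ xs →
      Δ (x ∷ p ++ s ∷ q) * ((z - x) * g z) ≡ (s - x) * ∏diff x xs * (Δ (p ++ s ∷ q) * g z)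
    term p z q eq = begin
      ∏diff x (p ++ s ∷ q) * Δ (p ++ s ∷ q) * ((z - x) * g z)
        ≡⟨ regroup (∏diff x (p ++ s ∷ q)) (Δ (p ++ s ∷ q)) (z - x) (g z) ⟩
      (z - x) * ∏diff x (p ++ s ∷ q) * (Δ (p ++ s ∷ q) * g z)
        ≡⟨ cong (_* (Δ (p ++ s ∷ q) * g z)) (∏diff-exchange x p q s z) ⟩
      (s - x) * ∏diff x (p ++ z ∷ q) * (Δ (p ++ s ∷ q) * g z)
        ≡⟨ cong (λ u → (s - x) * ∏diff x u * (Δ (p ++ s ∷ q) * g z)) eq ⟩
      (s - x) * ∏diff x xs * (Δ (p ++ s ∷ q) * g z) ∎

  lagrange-linear₁ : ∀ {n} → LagrangeIdentity (suc n) → ∀ x xs → length xs ≡ suc n → ∀ s →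
    ∑pick (x ∷ xs) (λ p z q → Δ (p ++ s ∷ q) * (z - x)) ≡ Δ (x ∷ xs) * (s - x)
  lagrange-linear₁ IH x xs len s = begin
    ∑pick (x ∷ xs) (λ p z q → Δ (p ++ s ∷ q) * (z - x))
      ≡⟨ ∑pick-cong (x ∷ xs) (λ p z q _ → cong (Δ (p ++ s ∷ q) *_) (sym (ℤ.*-identityʳ (z - x)))) ⟩
    ∑pick (x ∷ xs) (λ p z q → Δ (p ++ s ∷ q) * ((z - x) * 1ℤ))
      ≡⟨ lagrange-linear IH x xs len (λ _ → 1ℤ) (DegreeBelow-const 1ℤ) s ⟩
    Δ (x ∷ xs) * ((s - x) * 1ℤ)
      ≡⟨ cong (Δ (x ∷ xs) *_) (ℤ.*-identityʳ (s - x)) ⟩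
    Δ (x ∷ xs) * (s - x) ∎
    where open ≡-Reasoning

  ∑pick-Δ-swap₀₁ : ∀ x x′ l (h : ℤ → ℤ) s →
    ∑pick (x ∷ x′ ∷ l) (λ p z q → Δ (p ++ s ∷ q) * h z)
      ≡ - ∑pick (x′ ∷ x ∷ l) (λ p z q → Δ (p ++ s ∷ q) * h z)
  ∑pick-Δ-swap₀₁ x x′ l h s = begin
    Δ (s ∷ x′ ∷ l) * h x + (Δ (x ∷ s ∷ l) * h x′ + tail x x′)
      ≡⟨ cong₂ (λ u v → u * h x + (v * h x′ + tail x x′)) (Δ-swap₀₁ s x′ l) (Δ-swap₀₁ x s l) ⟩
    - Δ (x′ ∷ s ∷ l) * h x + (- Δ (s ∷ x ∷ l) * h x′ + tail x x′)
      ≡⟨ cong (λ u → - Δ (x′ ∷ s ∷ l) * h x + (- Δ (s ∷ x ∷ l) * h x′ + u)) tail-swap ⟩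
    - Δ (x′ ∷ s ∷ l) * h x + (- Δ (s ∷ x ∷ l) * h x′ + - tail x′ x)
      ≡⟨ regroup (Δ (x′ ∷ s ∷ l)) (h x) (Δ (s ∷ x ∷ l)) (h x′) (tail x′ x) ⟩
    - (Δ (s ∷ x ∷ l) * h x′ + (Δ (x′ ∷ s ∷ l) * h x + tail x′ x)) ∎
    where
    open ≡-Reasoning
    tail : ℤ → ℤ → ℤ
    tail y y′ = ∑pick l (λ p z q → Δ (y ∷ y′ ∷ p ++ s ∷ q) * h z)
    regroup : ∀ a b c d e → - a * b + (- c * d + - e) ≡ - (c * d + (a * b + e))
    regroup = solve-∀
    tail-swap : tail x x′ ≡ - tail x′ x
    tail-swap = begin
      tail x x′
        ≡⟨ ∑pick-cong l (λ p z q _ → trans (cong (_* h z) (Δ-swap₀₁ x x′ (p ++ s ∷ q)))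
                                           (sym (ℤ.neg-distribˡ-* (Δ (x′ ∷ x ∷ p ++ s ∷ q)) (h z)))) ⟩
      ∑pick l (λ p z q → - (Δ (x′ ∷ x ∷ p ++ s ∷ q) * h z))
        ≡⟨ ∑pick-neg l (λ p z q → Δ (x′ ∷ x ∷ p ++ s ∷ q) * h z) ⟩
      - tail x′ x ∎

  lagrange-difference : ∀ {n} → LagrangeIdentity (suc n) → ∀ x x′ l → length l ≡ n → ∀ s →
    ∑pick (x ∷ x′ ∷ l) (λ p _ q → Δ (p ++ s ∷ q)) * (x′ - x) ≡ Δ (x ∷ x′ ∷ l) * (x′ - x)
  lagrange-difference IH x x′ l len s = begin
    ∑pick X (λ p _ q → Δ (p ++ s ∷ q)) * (x′ - x)
      ≡⟨ ∑pick-*ʳ X (x′ - x) (λ p _ q → Δ (p ++ s ∷ q)) ⟨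
    ∑pick X (λ p _ q → Δ (p ++ s ∷ q) * (x′ - x))
      ≡⟨ ∑pick-cong X (λ p z q _ → difference (Δ (p ++ s ∷ q)) x x′ z) ⟩
    ∑pick X (λ p z q → Δ (p ++ s ∷ q) * (z - x) + - (Δ (p ++ s ∷ q) * (z - x′)))
      ≡⟨ ∑pick-+ X (λ p z q → Δ (p ++ s ∷ q) * (z - x)) (λ p z q → - (Δ (p ++ s ∷ q) * (z - x′))) ⟩
    ∑pick X (λ p z q → Δ (p ++ s ∷ q) * (z - x)) + ∑pick X (λ p z q → - (Δ (p ++ s ∷ q) * (z - x′)))
      ≡⟨ cong₂ _+_ (lagrange-linear₁ IH x (x′ ∷ l) (cong suc len) s)
                   (∑pick-neg X (λ p z q → Δ (p ++ s ∷ q) * (z - x′))) ⟩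
    Δ X * (s - x) + - ∑pick X (λ p z q → Δ (p ++ s ∷ q) * (z - x′))
      ≡⟨ cong (λ u → Δ X * (s - x) + - u) (∑pick-Δ-swap₀₁ x x′ l (_- x′) s) ⟩
    Δ X * (s - x) + - - ∑pick (x′ ∷ x ∷ l) (λ p z q → Δ (p ++ s ∷ q) * (z - x′))
      ≡⟨ cong (λ u → Δ X * (s - x) + - - u) (lagrange-linear₁ IH x′ (x ∷ l) (cong suc len) s) ⟩
    Δ X * (s - x) + - - (Δ (x′ ∷ x ∷ l) * (s - x′))
      ≡⟨ cong (λ u → Δ X * (s - x) + - - (u * (s - x′)))
              (trans (sym (ℤ.neg-involutive _)) (cong -_ (sym (Δ-swap₀₁ x x′ l)))) ⟩
    Δ X * (s - x) + - - (- Δ X * (s - x′))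
      ≡⟨ telescope (Δ X) s x x′ ⟩
    Δ X * (x′ - x) ∎
    where
    open ≡-Reasoning
    X = x ∷ x′ ∷ l
    difference : ∀ d x x′ z → d * (x′ - x) ≡ d * (z - x) + - (d * (z - x′))
    difference = solve-∀
    telescope : ∀ D s x x′ → D * (s - x) + - - (- D * (s - x′)) ≡ D * (x′ - x)
    telescope = solve-∀

  lagrange-repeated : ∀ x l s → ∑pick (x ∷ x ∷ l) (λ p _ q → Δ (p ++ s ∷ q)) ≡ Δ (x ∷ x ∷ l)
  lagrange-repeated x l s = begin
    Δ (s ∷ x ∷ l) + (Δ (x ∷ s ∷ l) + ∑pick l (λ p _ q → Δ (x ∷ x ∷ p ++ s ∷ q)))
      ≡⟨ cong₂ (λ u v → Δ (s ∷ x ∷ l) + (u + v)) (Δ-swap₀₁ x s l)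
               (trans (∑pick-cong l (λ p _ q _ → Δ-repeat₀₁ x (p ++ s ∷ q)))
                      (trans (∑pick-const l 0ℤ) (ℤ.*-zeroʳ (+ length l)))) ⟩
    Δ (s ∷ x ∷ l) + (- Δ (s ∷ x ∷ l) + 0ℤ)
      ≡⟨ cancel (Δ (s ∷ x ∷ l)) ⟩
    0ℤ
      ≡⟨ Δ-repeat₀₁ x l ⟨
    Δ (x ∷ x ∷ l) ∎
    where
    open ≡-Reasoning
    cancel : ∀ a → a + (- a + 0ℤ) ≡ 0ℤ
    cancel = solve-∀

  -- With S the left-hand side, the linear case at x and at x′ gives (x′ − x) (S − Δ X) = 0;
  -- cancel x′ − x unless x′ = x, in which case both sides vanish.
  lagrange-constant : ∀ {n} → LagrangeIdentity n → ∀ x xs → length xs ≡ n → ∀ s →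
    ∑pick (x ∷ xs) (λ p _ q → Δ (p ++ s ∷ q)) ≡ Δ (x ∷ xs)
  lagrange-constant         IH x []       _   s = refl
  lagrange-constant {suc n} IH x (x′ ∷ l) len s with x′ ℤ.≟ x
  ... | yes refl = lagrange-repeated x l s
  ... | no x′≢x  = ℤ.*-cancelʳ-≡ _ _ (x′ - x) {{≢-nonZero (λ eq → x′≢x (ℤ.i-j≡0⇒i≡j x′ x eq))}}
                     (lagrange-difference IH x x′ l (ℕ.suc-injective len) s)

  lagrange : ∀ n → LagrangeIdentity n
  lagrange zero    []       _   f f<0 s = sym (trans (ℤ.*-identityˡ (f s)) (DegreeBelow-zero f<0 s))
  lagrange (suc n) (x ∷ xs) len f f<n s with divide f<n x
  ... | g , g<n , f≡ = begin
    ∑pick (x ∷ xs) (λ p z q → Δ (p ++ s ∷ q) * f z)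
      ≡⟨ ∑pick-cong (x ∷ xs) (λ p z q _ → trans (cong (Δ (p ++ s ∷ q) *_) (f≡ z))
                                                (ℤ.*-distribˡ-+ (Δ (p ++ s ∷ q)) (f x) _)) ⟩
    ∑pick (x ∷ xs) (λ p z q → Δ (p ++ s ∷ q) * f x + Δ (p ++ s ∷ q) * ((z - x) * g z))
      ≡⟨ ∑pick-+ (x ∷ xs) (λ p z q → Δ (p ++ s ∷ q) * f x) (λ p z q → Δ (p ++ s ∷ q) * ((z - x) * g z)) ⟩
    ∑pick (x ∷ xs) (λ p z q → Δ (p ++ s ∷ q) * f x)
      + ∑pick (x ∷ xs) (λ p z q → Δ (p ++ s ∷ q) * ((z - x) * g z))
      ≡⟨ cong₂ _+_ (trans (∑pick-*ʳ (x ∷ xs) (f x) (λ p _ q → Δ (p ++ s ∷ q)))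
                          (cong (_* f x) (lagrange-constant (lagrange n) x xs len′ s)))
                   (lagrange-linear (lagrange n) x xs len′ g g<n s) ⟩
    Δ (x ∷ xs) * f x + Δ (x ∷ xs) * ((s - x) * g s)
      ≡⟨ ℤ.*-distribˡ-+ (Δ (x ∷ xs)) _ _ ⟨
    Δ (x ∷ xs) * (f x + (s - x) * g s)
      ≡⟨ cong (Δ (x ∷ xs) *_) (f≡ s) ⟨
    Δ (x ∷ xs) * f s ∎
    where
    open ≡-Reasoning
    len′ = ℕ.suc-injective len

  -- For each entry x of xs, t ↦ Δ (xs with x replaced by t) has degree < length ws, so the
  -- inner sum over the entries of ws is the Lagrange identity for ws evaluated at x.
  ∑exchange-Δ : ∀ xs ws → length xs ≤ length ws →
    ∑exchange xs ws (λ l l′ → Δ l * Δ l′) ≡ + length xs * (Δ xs * Δ ws)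
  ∑exchange-Δ xs ws xs≤ws = trans
    (∑pick-cong xs (λ p x s eq → begin
       ∑pick ws (λ p′ z s′ → Δ (p ++ z ∷ s) * Δ (p′ ++ x ∷ s′))
         ≡⟨ ∑pick-cong ws (λ p′ z s′ _ → ℤ.*-comm (Δ (p ++ z ∷ s)) _) ⟩
       ∑pick ws (λ p′ z s′ → Δ (p′ ++ x ∷ s′) * Δ (p ++ z ∷ s))
         ≡⟨ lagrange (length ws) ws refl (λ t → Δ (p ++ t ∷ s))
                     (DegreeBelow-mono (degree≤ p x s eq) (Δ-degree p s)) x ⟩
       Δ ws * Δ (p ++ x ∷ s)
         ≡⟨ cong (λ u → Δ ws * Δ u) eq ⟩
       Δ ws * Δ xs
         ≡⟨ ℤ.*-comm (Δ ws) (Δ xs) ⟩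
       Δ xs * Δ ws ∎))
    (∑pick-const xs (Δ xs * Δ ws))
    where
    open ≡-Reasoning
    degree≤ : ∀ p x s → p ++ x ∷ s ≡ xs → suc (length p ℕ.+ length s) ≤ length ws
    degree≤ p x s eq = ℕ.≤-trans (ℕ.≤-reflexive (begin
      suc (length p ℕ.+ length s) ≡⟨ ℕ.+-suc (length p) (length s) ⟨
      length p ℕ.+ length (x ∷ s) ≡⟨ length-++ p ⟨
      length (p ++ x ∷ s)         ≡⟨ cong length eq ⟩
      length xs                   ∎)) xs≤ws

module Specht where

  open import Data.Integer using (_+_; _*_; -_; _-_)
  open import Data.Integer.Tactic.RingSolver using (solve-∀)
  open import Data.List using (take; drop)
  open import Data.List.Properties using (take++drop≡id; length-take; length-drop)
  import Data.List.Relation.Unary.Unique.Propositional.Properties as Unique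
  open import Data.Nat using (_≤_)
  open SwapSums
  open Vandermonde
  open Lagrange

  contentSum : List ℕ → ℤ
  contentSum cs = + rowPairs cs - + columnPairs cs

  contentSum-∷ : ∀ c cs → contentSum (c ∷ cs) ≡ + (c ℕ.* length cs) - + choose2 c + contentSum cs
  contentSum-∷ c cs = begin
    + (c ℕ.* length cs ℕ.+ rowPairs cs) - + (choose2 c ℕ.+ columnPairs cs)
      ≡⟨ cong₂ _-_ (ℤ.pos-+ (c ℕ.* length cs) _) (ℤ.pos-+ (choose2 c) _) ⟩
    (+ (c ℕ.* length cs) + + rowPairs cs) - (+ choose2 c + + columnPairs cs)
      ≡⟨ regroup (+ (c ℕ.* length cs)) (+ rowPairs cs) (+ choose2 c) (+ columnPairs cs) ⟩
    + (c ℕ.* length cs) - + choose2 c + contentSum cs ∎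
    where
    open ≡-Reasoning
    regroup : ∀ a b c d → (a + b) - (c + d) ≡ a - c + (b - d)
    regroup = solve-∀

  contentSum-≡ : ∀ cs m → rowPairs cs ≡ columnPairs cs ℕ.+ m → contentSum cs ≡ + m
  contentSum-≡ cs m rows≡ = begin
    + rowPairs cs - + columnPairs cs       ≡⟨ cong (λ r → + r - + columnPairs cs) rows≡ ⟩
    + (columnPairs cs ℕ.+ m) - + columnPairs cs ≡⟨ cong (_- + columnPairs cs) (ℤ.pos-+ (columnPairs cs) m) ⟩
    + columnPairs cs + + m - + columnPairs cs   ≡⟨ cancel (+ columnPairs cs) (+ m) ⟩
    + m                                        ∎
    where
    open ≡-Reasoning
    cancel : ∀ p m → p + m - p ≡ m
    cancel = solve-∀

  specht : List ℕ → List ℤ → ℤ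
  specht []       l = 1ℤ
  specht (c ∷ cs) l = Δ (take c l) * specht cs (drop c l)

  take-length-++ : ∀ (xs ys : List ℤ) → take (length xs) (xs ++ ys) ≡ xs
  take-length-++ []       ys = refl
  take-length-++ (x ∷ xs) ys = cong (x ∷_) (take-length-++ xs ys)

  drop-length-++ : ∀ (xs ys : List ℤ) → drop (length xs) (xs ++ ys) ≡ ys
  drop-length-++ []       ys = refl
  drop-length-++ (x ∷ xs) ys = drop-length-++ xs ys

  specht-++ : ∀ {c} cs xs zs → length xs ≡ c → specht (c ∷ cs) (xs ++ zs) ≡ Δ xs * specht cs zs
  specht-++ cs xs zs refl = cong₂ (λ u v → Δ u * specht cs v) (take-length-++ xs zs) (drop-length-++ xs zs)

  specht≢0 : ∀ cs l → Unique l → specht cs l ≢ 0ℤ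
  specht≢0 []       l ul ()
  specht≢0 (c ∷ cs) l ul eq with ℤ.i*j≡0⇒i≡0∨j≡0 (Δ (take c l)) eq
  ... | inj₁ Δ≡0      = Δ≢0 (take c l) (Unique.take⁺ c ul) Δ≡0
  ... | inj₂ specht≡0 = specht≢0 cs (drop c l) (Unique.drop⁺ c ul) specht≡0

  split-block : ∀ c cs (l : List ℤ) → length l ≡ c ℕ.+ sum cs →
    length (take c l) ≡ c × length (drop c l) ≡ sum cs
  split-block c cs l len =
    trans (length-take c l) (ℕ.m≤n⇒m⊓n≡m (subst (c ℕ.≤_) (sym len) (ℕ.m≤m+n c (sum cs)))) ,
    trans (length-drop c l) (trans (cong (ℕ._∸ c) len) (ℕ.m+n∸m≡n c (sum cs)))

  ∑exchange-specht : ∀ cs xs zs → All (length xs ≤_) cs → length zs ≡ sum cs →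
    ∑exchange xs zs (λ l l′ → Δ l * specht cs l′) ≡ + (length xs ℕ.* length cs) * (Δ xs * specht cs zs)
  ∑exchange-specht []       xs []  []          _   = begin
    ∑pick xs (λ _ _ _ → 0ℤ)           ≡⟨ ∑pick-const xs 0ℤ ⟩
    + length xs * 0ℤ                   ≡⟨ ℤ.*-zeroʳ (+ length xs) ⟩
    0ℤ                                 ≡⟨ ℤ.*-zeroˡ (Δ xs * 1ℤ) ⟨
    0ℤ * (Δ xs * 1ℤ)                   ≡⟨ cong (λ n → + n * (Δ xs * 1ℤ)) (ℕ.*-zeroʳ (length xs)) ⟨
    + (length xs ℕ.* 0) * (Δ xs * 1ℤ) ∎
    where open ≡-Reasoning
  ∑exchange-specht (d ∷ cs) xs zs (xs≤d ∷ xs≤cs) len =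
    subst (λ u → ∑exchange xs u (λ l l′ → Δ l * specht (d ∷ cs) l′)
                   ≡ + (length xs ℕ.* suc (length cs)) * (Δ xs * specht (d ∷ cs) u))
          (take++drop≡id d zs) (uncurry (blocks (take d zs) (drop d zs)) (split-block d cs zs len))
    where
    open ≡-Reasoning
    blocks : ∀ ws us → length ws ≡ d → length us ≡ sum cs →
      ∑exchange xs (ws ++ us) (λ l l′ → Δ l * specht (d ∷ cs) l′)
        ≡ + (length xs ℕ.* suc (length cs)) * (Δ xs * specht (d ∷ cs) (ws ++ us))
    blocks ws us ws-len us-len = begin
      ∑exchange xs (ws ++ us) (λ l l′ → Δ l * specht (d ∷ cs) l′)
        ≡⟨ ∑exchange-++ʳ xs ws us (λ l l′ → Δ l * specht (d ∷ cs) l′) ⟩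
      ∑exchange xs ws (λ l l′ → Δ l * specht (d ∷ cs) (l′ ++ us))
        + ∑exchange xs us (λ l l′ → Δ l * specht (d ∷ cs) (ws ++ l′))
        ≡⟨ cong₂ _+_
             (∑exchange-cong xs ws (λ l l′ _ l′-len →
               trans (cong (Δ l *_) (specht-++ cs l′ us (trans l′-len ws-len))) (sym (ℤ.*-assoc (Δ l) (Δ l′) _))))
             (∑exchange-cong xs us (λ l l′ _ _ →
               trans (cong (Δ l *_) (specht-++ cs ws l′ ws-len)) (commute (Δ l) (Δ ws) (specht cs l′)))) ⟩
      ∑exchange xs ws (λ l l′ → Δ l * Δ l′ * specht cs us)
        + ∑exchange xs us (λ l l′ → Δ ws * (Δ l * specht cs l′))
        ≡⟨ cong₂ _+_ (∑exchange-*ʳ xs ws (specht cs us) (λ l l′ → Δ l * Δ l′))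
                     (∑exchange-*ˡ xs us (Δ ws) (λ l l′ → Δ l * specht cs l′)) ⟩
      ∑exchange xs ws (λ l l′ → Δ l * Δ l′) * specht cs us
        + Δ ws * ∑exchange xs us (λ l l′ → Δ l * specht cs l′)
        ≡⟨ cong₂ (λ u v → u * specht cs us + Δ ws * v)
                 (∑exchange-Δ xs ws (subst (length xs ≤_) (sym ws-len) xs≤d))
                 (∑exchange-specht cs xs us xs≤cs us-len) ⟩
      + length xs * (Δ xs * Δ ws) * specht cs us
        + Δ ws * (+ (length xs ℕ.* length cs) * (Δ xs * specht cs us))
        ≡⟨ cong (λ u → + length xs * (Δ xs * Δ ws) * specht cs us + Δ ws * (u * (Δ xs * specht cs us)))
                (ℤ.pos-* (length xs) (length cs)) ⟩
      + length xs * (Δ xs * Δ ws) * specht cs us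
        + Δ ws * (+ length xs * + length cs * (Δ xs * specht cs us))
        ≡⟨ collect (+ length xs) (+ length cs) (Δ xs) (Δ ws) (specht cs us) ⟩
      + length xs * (1ℤ + + length cs) * (Δ xs * (Δ ws * specht cs us))
        ≡⟨ cong₂ (λ u v → u * (Δ xs * v)) (sym (ℤ.pos-* (length xs) (suc (length cs))))
                 (sym (specht-++ cs ws us ws-len)) ⟩
      + (length xs ℕ.* suc (length cs)) * (Δ xs * specht (d ∷ cs) (ws ++ us)) ∎
      where
      commute : ∀ a b c → a * (b * c) ≡ b * (a * c)
      commute = solve-∀
      collect : ∀ n k a b f → n * (a * b) * f + b * (n * k * (a * f)) ≡ n * (1ℤ + k) * (a * (b * f))
      collect = solve-∀

  specht-eigen : ∀ cs l → AllPairs ℕ._≤_ cs → length l ≡ sum cs →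
    ∑swap l (specht cs) ≡ contentSum cs * specht cs l
  specht-eigen []       [] _                _   = refl
  specht-eigen (c ∷ cs) l  (c≤cs ∷ cs-asc) len =
    subst (λ u → ∑swap u (specht (c ∷ cs)) ≡ contentSum (c ∷ cs) * specht (c ∷ cs) u)
          (take++drop≡id c l) (uncurry (blocks (take c l) (drop c l)) (split-block c cs l len))
    where
    open ≡-Reasoning
    blocks : ∀ xs zs → length xs ≡ c → length zs ≡ sum cs →
      ∑swap (xs ++ zs) (specht (c ∷ cs)) ≡ contentSum (c ∷ cs) * specht (c ∷ cs) (xs ++ zs)
    blocks xs zs refl zs-len = begin
      ∑swap (xs ++ zs) (specht (c ∷ cs))
        ≡⟨ ∑swap-++ xs zs (specht (c ∷ cs)) ⟩
      ∑swap xs (λ l → specht (c ∷ cs) (l ++ zs)) + ∑swap zs (λ l → specht (c ∷ cs) (xs ++ l))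
        + ∑exchange xs zs (λ l l′ → specht (c ∷ cs) (l ++ l′))
        ≡⟨ cong₂ _+_ (cong₂ _+_ inside-first inside-rest) across ⟩
      specht cs zs * (- + choose2 c * Δ xs) + Δ xs * (contentSum cs * specht cs zs)
        + + (c ℕ.* length cs) * (Δ xs * specht cs zs)
        ≡⟨ collect (specht cs zs) (+ choose2 c) (Δ xs) (contentSum cs) (+ (c ℕ.* length cs)) ⟩
      (+ (c ℕ.* length cs) - + choose2 c + contentSum cs) * (Δ xs * specht cs zs)
        ≡⟨ cong₂ _*_ (contentSum-∷ c cs) (specht-++ cs xs zs refl) ⟨
      contentSum (c ∷ cs) * specht (c ∷ cs) (xs ++ zs) ∎
      where
      inside-first : ∑swap xs (λ l → specht (c ∷ cs) (l ++ zs)) ≡ specht cs zs * (- + choose2 c * Δ xs)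
      inside-first = begin
        ∑swap xs (λ l → specht (c ∷ cs) (l ++ zs))
          ≡⟨ ∑swap-cong xs (λ l l-len → trans (specht-++ cs l zs l-len) (ℤ.*-comm (Δ l) (specht cs zs))) ⟩
        ∑swap xs (λ l → specht cs zs * Δ l)
          ≡⟨ ∑swap-*ˡ xs (specht cs zs) Δ ⟩
        specht cs zs * ∑swap xs Δ
          ≡⟨ cong (specht cs zs *_) (∑swap-Δ xs) ⟩
        specht cs zs * (- + choose2 c * Δ xs) ∎
      inside-rest : ∑swap zs (λ l → specht (c ∷ cs) (xs ++ l)) ≡ Δ xs * (contentSum cs * specht cs zs)
      inside-rest = begin
        ∑swap zs (λ l → specht (c ∷ cs) (xs ++ l)) ≡⟨ ∑swap-cong zs (λ l _ → specht-++ cs xs l refl) ⟩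
        ∑swap zs (λ l → Δ xs * specht cs l)         ≡⟨ ∑swap-*ˡ zs (Δ xs) (specht cs) ⟩
        Δ xs * ∑swap zs (specht cs)                 ≡⟨ cong (Δ xs *_) (specht-eigen cs zs cs-asc zs-len) ⟩
        Δ xs * (contentSum cs * specht cs zs)       ∎
      across : ∑exchange xs zs (λ l l′ → specht (c ∷ cs) (l ++ l′))
                 ≡ + (c ℕ.* length cs) * (Δ xs * specht cs zs)
      across = trans (∑exchange-cong xs zs (λ l l′ l-len _ → specht-++ cs l l′ l-len))
                     (∑exchange-specht cs xs zs c≤cs zs-len)
      collect : ∀ F c2 D E k → F * (- c2 * D) + D * (E * F) + k * (D * F) ≡ (k - c2 + E) * (D * F)
      collect = solve-∀

module Permutations where

  open import Data.Empty using (⊥-elim)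
  open import Data.Fin using (Fin; zero; suc; _≟_; punchOut)
  import Data.Fin.Properties as Fin
  open import Data.List using (map; tabulate; allFin)
  open import Data.List.Membership.Propositional using (_∈_; lose)
  open import Data.List.Membership.Propositional.Properties
    using (∈-map⁺; ∈-map⁻; ∈-filter⁺; ∈-filter⁻; ∈-allFin; ∈-tabulate⁺; ∈-concatMap⁺)
  open import Data.List.Relation.Binary.Disjoint.Propositional using (Disjoint)
  open import Data.List.Relation.Unary.Any using (here)
  import Data.List.Relation.Unary.All as All
  import Data.List.Relation.Unary.All.Properties as All
  import Data.List.Relation.Unary.AllPairs as AllPairs
  import Data.List.Relation.Unary.AllPairs.Properties as AllPairs
  import Data.List.Relation.Unary.Unique.Propositional.Properties as Unique
  open import Data.Product using (∃)
  open import Data.Vec using (Vec; []; _∷_; lookup; toList)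
  import Data.Vec as Vec
  import Data.Vec.Properties as Vec
  open import Data.Vec.Functional using (updateAt)
  open import Data.Vec.Functional.Properties using (updateAt-updates; updateAt-minimal)
  open import Function using (_∘_)
  open import Relation.Nullary using (Dec; does)
  open import Relation.Nullary.Decidable using (dec-true; dec-false)

  module _ {n} (i j : Fin n) where

    swapFin-left : swapFin i j i ≡ j
    swapFin-left rewrite dec-true (i ≟ i) refl = refl

    swapFin-right : swapFin i j j ≡ i
    swapFin-right = by-cases (j ≟ i)
      where
      by-cases : Dec (j ≡ i) → swapFin i j j ≡ i
      by-cases (yes refl) = swapFin-left
      by-cases (no j≢i) rewrite dec-false (j ≟ i) j≢i | dec-true (j ≟ j) refl = refl

    swapFin-other : ∀ {k} → k ≢ i → k ≢ j → swapFin i j k ≡ k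
    swapFin-other {k} k≢i k≢j rewrite dec-false (k ≟ i) k≢i | dec-false (k ≟ j) k≢j = refl

    swapFin-involutive : ∀ k → swapFin i j (swapFin i j k) ≡ k
    swapFin-involutive k = by-cases (k ≟ i) (k ≟ j)
      where
      by-cases : Dec (k ≡ i) → Dec (k ≡ j) → swapFin i j (swapFin i j k) ≡ k
      by-cases (yes refl) _          = trans (cong (swapFin i j) swapFin-left) swapFin-right
      by-cases (no k≢i)   (yes refl) = trans (cong (swapFin i j) swapFin-right) swapFin-left
      by-cases (no k≢i)   (no k≢j)   = trans (cong (swapFin i j) (swapFin-other k≢i k≢j)) (swapFin-other k≢i k≢j)

    swapFin-≟ : ∀ a k → does (swapFin i j a ≟ k) ≡ does (a ≟ swapFin i j k)
    swapFin-≟ a k with swapFin i j a ≟ k | a ≟ swapFin i j k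
    ... | yes _  | yes _  = refl
    ... | no _   | no _   = refl
    ... | yes eq | no neq = ⊥-elim (neq (trans (sym (swapFin-involutive a)) (cong (swapFin i j) eq)))
    ... | no neq | yes eq = ⊥-elim (neq (trans (cong (swapFin i j) eq) (swapFin-involutive k)))

  swapFin-suc : ∀ {n} (i j k : Fin n) → swapFin (suc i) (suc j) (suc k) ≡ suc (swapFin i j k)
  swapFin-suc i j k = by-cases (k ≟ i) (k ≟ j)
    where
    by-cases : Dec (k ≡ i) → Dec (k ≡ j) → swapFin (suc i) (suc j) (suc k) ≡ suc (swapFin i j k)
    by-cases (yes refl) _          = trans (swapFin-left (suc k) (suc j)) (cong suc (sym (swapFin-left k j)))
    by-cases (no k≢i)   (yes refl) = trans (swapFin-right (suc i) (suc k)) (cong suc (sym (swapFin-right i k)))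
    by-cases (no k≢i)   (no k≢j)   =
      trans (swapFin-other (suc i) (suc j) (k≢i ∘ Fin.suc-injective) (k≢j ∘ Fin.suc-injective))
            (cong suc (sym (swapFin-other i j k≢i k≢j)))

  swapFin-zero-suc : ∀ {n} {A : Set} (y : Fin (suc n) → A) (j k : Fin n) →
    y (swapFin zero (suc j) (suc k)) ≡ updateAt (y ∘ suc) j (λ _ → y zero) k
  swapFin-zero-suc y j k = by-cases (k ≟ j)
    where
    by-cases : Dec (k ≡ j) → y (swapFin zero (suc j) (suc k)) ≡ updateAt (y ∘ suc) j (λ _ → y zero) k
    by-cases (yes refl) = trans (cong y (swapFin-right zero (suc k))) (sym (updateAt-updates k (y ∘ suc)))
    by-cases (no k≢j)   = trans (cong y (swapFin-other zero (suc j) (λ ()) (k≢j ∘ Fin.suc-injective)))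
                                (sym (updateAt-minimal k j (y ∘ suc) k≢j))

  lookup-transposition-∘ : ∀ {n} (i j : Fin n) (f : Word n) x →
    lookup (transposition i j ∘ₚ f) x ≡ swapFin i j (lookup f x)
  lookup-transposition-∘ i j f x =
    trans (Vec.lookup∘tabulate _ x) (Vec.lookup∘tabulate (swapFin i j) (lookup f x))

  identity : ∀ {n} → Word n
  identity = Vec.tabulate (λ x → x)

  toList≡tabulate-lookup : ∀ {A : Set} {n} (w : Vec A n) → toList w ≡ tabulate (lookup w)
  toList≡tabulate-lookup []       = refl
  toList≡tabulate-lookup (x ∷ w) = cong (x ∷_) (toList≡tabulate-lookup w)

  tabulate-injective : ∀ {A : Set} {n} (h : Fin n → A) → Unique (tabulate h) → ∀ {x y} → h x ≡ h y → x ≡ y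
  tabulate-injective h (h₀∉ ∷ _) {zero}  {zero}  _  = refl
  tabulate-injective h (h₀∉ ∷ _) {zero}  {suc y} eq = ⊥-elim (All.lookup h₀∉ (∈-tabulate⁺ y) eq)
  tabulate-injective h (h₀∉ ∷ _) {suc x} {zero}  eq = ⊥-elim (All.lookup h₀∉ (∈-tabulate⁺ x) (sym eq))
  tabulate-injective h (_ ∷ uh)  {suc x} {suc y} eq = cong suc (tabulate-injective (h ∘ suc) uh eq)

  IsPerm⇒injective : ∀ {n} (g : Word n) → IsPerm g → ∀ {x y} → lookup g x ≡ lookup g y → x ≡ y
  IsPerm⇒injective g g-perm = tabulate-injective (lookup g) (subst Unique (toList≡tabulate-lookup g) g-perm)

  injective⇒IsPerm : ∀ {n} (g : Word n) → (∀ {x y} → lookup g x ≡ lookup g y → x ≡ y) → IsPerm g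
  injective⇒IsPerm g g-inj = subst Unique (sym (toList≡tabulate-lookup g)) (Unique.tabulate⁺ g-inj)

  IsPerm⇒surjective : ∀ {n} (g : Word n) → IsPerm g → ∀ i → ∃ λ x → lookup g x ≡ i
  IsPerm⇒surjective {suc n} g g-perm i with Fin.any? (λ x → lookup g x ≟ i)
  ... | yes hit = hit
  ... | no miss with Fin.pigeonhole (ℕ.n<1+n n) (λ x → punchOut {i = i} (λ eq → miss (x , sym eq)))
  ...   | a , b , a<b , eq = ⊥-elim (Fin.<-irrefl (IsPerm⇒injective g g-perm
            (Fin.punchOut-injective (λ eq′ → miss (a , sym eq′)) (λ eq′ → miss (b , sym eq′)) eq)) a<b)

  Word-ext : ∀ {n} (u w : Word n) → (∀ x → lookup u x ≡ lookup w x) → u ≡ w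
  Word-ext u w u≗w = trans (sym (Vec.tabulate∘lookup u)) (trans (Vec.tabulate-cong u≗w) (Vec.tabulate∘lookup w))

  transposition-involutive : ∀ {n} (i j : Fin n) (g : Word n) →
    transposition i j ∘ₚ (transposition i j ∘ₚ g) ≡ g
  transposition-involutive i j g = Word-ext _ g (λ x → begin
    lookup (transposition i j ∘ₚ (transposition i j ∘ₚ g)) x
      ≡⟨ lookup-transposition-∘ i j (transposition i j ∘ₚ g) x ⟩
    swapFin i j (lookup (transposition i j ∘ₚ g) x)
      ≡⟨ cong (swapFin i j) (lookup-transposition-∘ i j g x) ⟩
    swapFin i j (swapFin i j (lookup g x))
      ≡⟨ swapFin-involutive i j (lookup g x) ⟩
    lookup g x ∎)
    where open ≡-Reasoning

  transposition-∘-IsPerm : ∀ {n} (i j : Fin n) (f : Word n) → IsPerm f → IsPerm (transposition i j ∘ₚ f)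
  transposition-∘-IsPerm i j f f-perm = injective⇒IsPerm _ (λ {x} {y} eq → IsPerm⇒injective f f-perm (begin
    lookup f x                            ≡⟨ swapFin-involutive i j (lookup f x) ⟨
    swapFin i j (swapFin i j (lookup f x)) ≡⟨ cong (swapFin i j) (trans (sym (lookup-transposition-∘ i j f x))
                                                                 (trans eq (lookup-transposition-∘ i j f y))) ⟩
    swapFin i j (swapFin i j (lookup f y)) ≡⟨ swapFin-involutive i j (lookup f y) ⟩
    lookup f y                            ∎))
    where open ≡-Reasoning

  allVecs-complete : ∀ {m k} (w : Vec (Fin k) m) → w ∈ allVecs m k
  allVecs-complete []      = here refl
  allVecs-complete {suc m} {k} (x ∷ w) =
    ∈-concatMap⁺ (λ y → map (y ∷_) (allVecs m k)) (lose (∈-allFin x) (∈-map⁺ (x ∷_) (allVecs-complete w)))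

  allVecs-unique : ∀ m k → Unique (allVecs m k)
  allVecs-unique zero    k = [] ∷ []
  allVecs-unique (suc m) k = Unique.concat⁺
    (All.map⁺ (All.universal (λ x → Unique.map⁺ Vec.∷-injectiveʳ (allVecs-unique m k)) (allFin k)))
    (AllPairs.map⁺ (AllPairs.map disjoint (Unique.allFin⁺ k)))
    where
    disjoint : ∀ {x y} → x ≢ y → Disjoint (map (x ∷_) (allVecs m k)) (map (y ∷_) (allVecs m k))
    disjoint x≢y (v∈x , v∈y) with ∈-map⁻ (_ ∷_) v∈x | ∈-map⁻ (_ ∷_) v∈y
    ... | _ , _ , refl | _ , _ , eq = x≢y (Vec.∷-injectiveˡ eq)

  ∈Sym⁺ : ∀ {n} {g : Word n} → IsPerm g → g ∈ Sym n
  ∈Sym⁺ g-perm = ∈-filter⁺ isPerm? (allVecs-complete _) g-perm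

  ∈Sym⁻ : ∀ {n} {g : Word n} → g ∈ Sym n → IsPerm g
  ∈Sym⁻ {n} g∈ = proj₂ (∈-filter⁻ isPerm? {xs = allVecs n n} g∈)

  identity-IsPerm : ∀ {n} → IsPerm (identity {n})
  identity-IsPerm = injective⇒IsPerm identity (λ {x} {y} eq →
    trans (sym (Vec.lookup∘tabulate (λ x → x) x)) (trans eq (Vec.lookup∘tabulate (λ x → x) y)))

module CayleyGraph where

  open import Algebra.Properties.Monoid.Sum ℤ.+-0-monoid using (sum-syntax; sum-cong-≗; sum-replicate-zero)
  open import Data.Integer using (_+_; _*_)
  open import Data.Bool using (if_then_else_)
  open import Data.Empty using (⊥-elim)
  open import Data.Fin using (Fin; zero; suc; toℕ; _≟_; _<_)
  import Data.Fin.Properties as Fin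
  open import Data.List using (map; tabulate; filter; allFin)
  open import Data.List.Properties using (map-++; map-∘; map-cong; map-tabulate)
  import Data.List.Properties as List
  open import Data.List.Membership.Propositional using (_∈_; lose)
  open import Data.List.Membership.Propositional.Properties
    using (∈-map⁺; ∈-map⁻; ∈-++⁺ˡ; ∈-++⁺ʳ; ∈-++⁻; ∈-filter⁺; ∈-filter⁻; ∈-allFin; ∈-tabulate⁺; ∈-tabulate⁻;
           ∈-cartesianProduct⁺)
  open import Data.List.Membership.Propositional.Properties.WithK using (unique∧set⇒bag)
  open import Data.List.Relation.Binary.BagAndSetEquality using (∼bag⇒↭)
  open import Data.List.Relation.Binary.Disjoint.Propositional using (Disjoint)
  open import Data.List.Relation.Binary.Permutation.Propositional using (_↭_; ↭⇒↭ₛ)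
  import Data.List.Relation.Binary.Permutation.Propositional.Properties as ↭
  open import Data.List.Relation.Binary.Permutation.Setoid.Properties (setoid ℤ) using (foldr-commMonoid)
  open import Data.List.Relation.Unary.Any using (here; there; satisfied)
  import Data.List.Relation.Unary.All as All
  import Data.List.Relation.Unary.All.Properties as All
  import Data.List.Relation.Unary.Unique.Propositional.Properties as Unique
  open import Data.Nat using (z≤n; s≤s)
  import Data.Product as Product
  open import Data.Vec using (lookup)
  import Data.Vec.Properties as Vec
  open import Data.Vec.Functional using (updateAt)
  open import Function using (_∘_; mk⇔)
  open import Relation.Nullary using (Dec; does)
  open SwapSums
  open Specht
  open Permutations

  sumℤ-++ : ∀ xs ys → sumℤ (xs ++ ys) ≡ sumℤ xs + sumℤ ys
  sumℤ-++ []       ys = sym (ℤ.+-identityˡ (sumℤ ys))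
  sumℤ-++ (x ∷ xs) ys = trans (cong (_+_ x) (sumℤ-++ xs ys)) (sym (ℤ.+-assoc x (sumℤ xs) (sumℤ ys)))

  sumℤ-↭ : ∀ {xs ys} → xs ↭ ys → sumℤ xs ≡ sumℤ ys
  sumℤ-↭ xs↭ys = foldr-commMonoid ℤ.+-0-isCommutativeMonoid (↭⇒↭ₛ xs↭ys)

  sumℤ-tabulate : ∀ {n} (f : Fin n → ℤ) → sumℤ (tabulate f) ≡ ∑[ j < n ] f j
  sumℤ-tabulate {zero}  f = refl
  sumℤ-tabulate {suc n} f = cong (_+_ (f zero)) (sumℤ-tabulate (f ∘ suc))

  ∑pick-tabulate : ∀ {n} (g : Fin n → ℤ) t (G : ℤ → List ℤ → ℤ) →
    ∑pick (tabulate g) (λ p z s → G z (p ++ t ∷ s)) ≡ ∑[ j < n ] G (g j) (tabulate (updateAt g j (λ _ → t)))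
  ∑pick-tabulate {zero}  g t G = refl
  ∑pick-tabulate {suc n} g t G =
    cong (_+_ (G (g zero) (t ∷ tabulate (g ∘ suc)))) (∑pick-tabulate (g ∘ suc) t (λ z l → G z (g zero ∷ l)))

  pairs : ∀ n → List (Fin n × Fin n)
  pairs zero    = []
  pairs (suc n) = tabulate (λ j → zero , suc j) ++ map (Product.map suc suc) (pairs n)

  ∑pairs-swap : ∀ {n} (y : Fin n → ℤ) (H : List ℤ → ℤ) →
    sumℤ (map (λ p → H (tabulate (y ∘ uncurry swapFin p))) (pairs n)) ≡ ∑swap (tabulate y) H
  ∑pairs-swap {zero}  y H = refl
  ∑pairs-swap {suc n} y H = begin
    sumℤ (map F (tabulate (λ j → zero , suc j) ++ map (Product.map suc suc) (pairs n)))
      ≡⟨ trans (cong sumℤ (map-++ F (tabulate (λ j → zero , suc j)) (map (Product.map suc suc) (pairs n))))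
               (sumℤ-++ (map F (tabulate (λ j → zero , suc j))) (map F (map (Product.map suc suc) (pairs n)))) ⟩
    sumℤ (map F (tabulate (λ j → zero , suc j))) + sumℤ (map F (map (Product.map suc suc) (pairs n)))
      ≡⟨ cong₂ _+_ (trans (cong sumℤ (map-tabulate (λ j → zero , suc j) F))
                          (sumℤ-tabulate (F ∘ (λ j → zero , suc j))))
                   (cong sumℤ (sym (map-∘ (pairs n)))) ⟩
    ∑[ j < n ] H (y (suc j) ∷ tabulate (λ k → y (swapFin zero (suc j) (suc k))))
      + sumℤ (map (λ p → H (y zero ∷ tabulate (λ k → y (uncurry swapFin (Product.map suc suc p) (suc k))))) (pairs n))
      ≡⟨ cong₂ _+_
           (sum-cong-≗ (λ j → cong (λ l → H (y (suc j) ∷ l)) (List.tabulate-cong (swapFin-zero-suc y j))))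
           (cong sumℤ (map-cong (λ p → cong (λ l → H (y zero ∷ l))
             (List.tabulate-cong (λ k → cong y (swapFin-suc (proj₁ p) (proj₂ p) k)))) (pairs n))) ⟩
    ∑[ j < n ] H (y (suc j) ∷ tabulate (updateAt (y ∘ suc) j (λ _ → y zero)))
      + sumℤ (map (λ p → H (y zero ∷ tabulate (y ∘ suc ∘ uncurry swapFin p))) (pairs n))
      ≡⟨ cong₂ _+_ (sym (∑pick-tabulate (y ∘ suc) (y zero) (λ z l → H (z ∷ l))))
                   (∑pairs-swap (y ∘ suc) (λ l → H (y zero ∷ l))) ⟩
    ∑swap (tabulate y) H ∎
    where
    open ≡-Reasoning
    F : Fin (suc n) × Fin (suc n) → ℤ
    F p = H (tabulate (y ∘ uncurry swapFin p))

  -- g⁻¹ k for a permutation g, written as a sum so that no inverse is needed; composing with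
  -- a transposition on the left exchanges two entries of positions g.
  position : ∀ {n} → Word n → Fin n → ℤ
  position {n} g k = ∑[ x < n ] (if does (lookup g x ≟ k) then + toℕ x else 0ℤ)

  positions : ∀ {n} → Word n → List ℤ
  positions g = tabulate (position g)

  position-transposition-∘ : ∀ {n} (i j : Fin n) (f : Word n) k →
    position (transposition i j ∘ₚ f) k ≡ position f (swapFin i j k)
  position-transposition-∘ i j f k = sum-cong-≗ (λ x → cong (λ b → if b then + toℕ x else 0ℤ)
    (trans (cong (λ a → does (a ≟ k)) (lookup-transposition-∘ i j f x)) (swapFin-≟ i j (lookup f x) k)))

  ∑-indicator : ∀ {n} (k : Fin n) (g : Fin n → ℤ) → ∑[ x < n ] (if does (x ≟ k) then g x else 0ℤ) ≡ g k
  ∑-indicator {suc n} zero    g = trans (cong (_+_ (g zero)) (sum-replicate-zero n)) (ℤ.+-identityʳ (g zero))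
  ∑-indicator {suc n} (suc k) g = trans (ℤ.+-identityˡ _) (∑-indicator k (g ∘ suc))

  position-identity : ∀ {n} (k : Fin n) → position identity k ≡ + toℕ k
  position-identity k = trans
    (sum-cong-≗ (λ x → cong (λ a → if does (a ≟ k) then + toℕ x else 0ℤ) (Vec.lookup∘tabulate (λ x → x) x)))
    (∑-indicator k (λ x → + toℕ x))

  pairs-sound : ∀ {n} {p : Fin n × Fin n} → p ∈ pairs n → proj₁ p < proj₂ p
  pairs-sound {suc n} p∈ with ∈-++⁻ (tabulate (λ j → zero , suc j)) p∈
  ... | inj₁ p∈₁ with ∈-tabulate⁻ p∈₁
  ...   | j , refl = s≤s z≤n
  pairs-sound {suc n} p∈ | inj₂ p∈₂ with ∈-map⁻ (Product.map suc suc) p∈₂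
  ...   | q , q∈ , refl = s≤s (pairs-sound q∈)

  pairs-complete : ∀ {n} {i j : Fin n} → i < j → (i , j) ∈ pairs n
  pairs-complete {suc n} {zero}  {suc j} _         = ∈-++⁺ˡ (∈-tabulate⁺ j)
  pairs-complete {suc n} {suc i} {suc j} (s≤s i<j) =
    ∈-++⁺ʳ (tabulate (λ j → zero , suc j)) (∈-map⁺ (Product.map suc suc) (pairs-complete i<j))

  pairs-unique : ∀ n → Unique (pairs n)
  pairs-unique zero    = []
  pairs-unique (suc n) = Unique.++⁺
    (Unique.tabulate⁺ (λ eq → Fin.suc-injective (cong proj₂ eq)))
    (Unique.map⁺ (λ eq → cong₂ _,_ (Fin.suc-injective (cong proj₁ eq)) (Fin.suc-injective (cong proj₂ eq)))
                 (pairs-unique n))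
    disjoint
    where
    disjoint : Disjoint (tabulate (λ j → zero , suc j)) (map (Product.map suc suc) (pairs n))
    disjoint (v∈₁ , v∈₂) with ∈-tabulate⁻ {f = λ j → zero , suc j} v∈₁ | ∈-map⁻ (Product.map suc suc) v∈₂
    ... | _ , refl | _ , _ , ()

  neighbours : ∀ {n} → Word n → List (Word n)
  neighbours {n} f = map (λ p → uncurry transposition p ∘ₚ f) (pairs n)

  transposition-∘-injective : ∀ {n} (f : Word n) → IsPerm f → ∀ {p q} → p ∈ pairs n → q ∈ pairs n →
    uncurry transposition p ∘ₚ f ≡ uncurry transposition q ∘ₚ f → p ≡ q
  transposition-∘-injective f f-perm {i , j} {k , l} p∈ q∈ eq with IsPerm⇒surjective f f-perm i
  ... | x , fx≡i = by-cases (i ≟ k) (i ≟ l)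
    where
    open ≡-Reasoning
    k-l-sends-i-to-j : swapFin k l i ≡ j
    k-l-sends-i-to-j = begin
      swapFin k l i                     ≡⟨ cong (swapFin k l) fx≡i ⟨
      swapFin k l (lookup f x)           ≡⟨ lookup-transposition-∘ k l f x ⟨
      lookup (transposition k l ∘ₚ f) x ≡⟨ cong (λ w → lookup w x) eq ⟨
      lookup (transposition i j ∘ₚ f) x ≡⟨ lookup-transposition-∘ i j f x ⟩
      swapFin i j (lookup f x)           ≡⟨ cong (swapFin i j) fx≡i ⟩
      swapFin i j i                     ≡⟨ swapFin-left i j ⟩
      j                                 ∎
    by-cases : Dec (i ≡ k) → Dec (i ≡ l) → (i , j) ≡ (k , l)
    by-cases (yes refl) _          = cong (i ,_) (trans (sym k-l-sends-i-to-j) (swapFin-left i l))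
    by-cases (no i≢k)   (yes refl) = ⊥-elim (Fin.<-asym (pairs-sound p∈)
      (subst (_< i) (trans (sym (swapFin-right k i)) k-l-sends-i-to-j) (pairs-sound q∈)))
    by-cases (no i≢k)   (no i≢l)   =
      ⊥-elim (Fin.<-irrefl (trans (sym (swapFin-other k l i≢k i≢l)) k-l-sends-i-to-j) (pairs-sound p∈))

  map-unique : ∀ {A B : Set} (g : A → B) {xs} → Unique xs →
    (∀ {a b} → a ∈ xs → b ∈ xs → g a ≡ g b → a ≡ b) → Unique (map g xs)
  map-unique g []          _     = []
  map-unique g (x∉ ∷ uxs) g-inj =
    All.map⁺ (All.tabulate (λ y∈ eq → All.lookup x∉ y∈ (g-inj (here refl) (there y∈) eq)))
    ∷ map-unique g uxs (λ a∈ b∈ → g-inj (there a∈) (there b∈))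

  neighbours-unique : ∀ {n} (f : Word n) → IsPerm f → Unique (neighbours f)
  neighbours-unique {n} f f-perm = map-unique _ (pairs-unique n) (transposition-∘-injective f f-perm)

  adjacent⇒neighbour : ∀ {n} (f : Word n) {g} → g ∈ filter (adj? f) (Sym n) → g ∈ neighbours f
  adjacent⇒neighbour {n} f {g} g∈ with satisfied (proj₂ (∈-filter⁻ (adj? f) {xs = Sym n} g∈))
  ... | (i , j) , i<j , f≡tg = subst (_∈ neighbours f)
          (trans (cong (transposition i j ∘ₚ_) f≡tg) (transposition-involutive i j g))
          (∈-map⁺ (λ p → uncurry transposition p ∘ₚ f) (pairs-complete i<j))

  neighbour⇒adjacent : ∀ {n} (f : Word n) → IsPerm f → ∀ {g} → g ∈ neighbours f → g ∈ filter (adj? f) (Sym n)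
  neighbour⇒adjacent {n} f f-perm g∈ with ∈-map⁻ (λ p → uncurry transposition p ∘ₚ f) g∈
  ... | (i , j) , p∈ , refl = ∈-filter⁺ (adj? f) (∈Sym⁺ (transposition-∘-IsPerm i j f f-perm))
        (lose (∈-cartesianProduct⁺ (∈-allFin i) (∈-allFin j)) (pairs-sound p∈ , sym (transposition-involutive i j f)))

  adjAct-neighbours : ∀ {n} (v : Word n → ℤ) (f : Word n) → f ∈ Sym n → adjAct v f ≡ sumℤ (map v (neighbours f))
  adjAct-neighbours {n} v f f∈ = sumℤ-↭ (↭.map⁺ v (∼bag⇒↭ (unique∧set⇒bag
    (Unique.filter⁺ (adj? f) (Unique.filter⁺ isPerm? (allVecs-unique n n)))
    (neighbours-unique f (∈Sym⁻ f∈))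
    (mk⇔ (adjacent⇒neighbour f) (neighbour⇒adjacent f (∈Sym⁻ f∈))))))

  contentSum-isEigenvalue : ∀ n cs → AllPairs ℕ._≤_ cs → sum cs ≡ n → IsEigenvalue n (contentSum cs)
  contentSum-isEigenvalue n cs cs-asc size = v , lose (∈Sym⁺ identity-IsPerm) v-identity≢0 , eigen
    where
    open ≡-Reasoning
    v : Word n → ℤ
    v g = specht cs (positions g)
    v-identity≢0 : v identity ≢ 0ℤ
    v-identity≢0 = subst (λ l → specht cs l ≢ 0ℤ) (sym (List.tabulate-cong position-identity))
      (specht≢0 cs _ (Unique.tabulate⁺ (λ eq → Fin.toℕ-injective (ℤ.+-injective eq))))
    eigen : ∀ f → f ∈ Sym n → adjAct v f ≡ contentSum cs * v f
    eigen f f∈ = begin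
      adjAct v f
        ≡⟨ adjAct-neighbours v f f∈ ⟩
      sumℤ (map v (neighbours f))
        ≡⟨ cong sumℤ (map-∘ (pairs n)) ⟨
      sumℤ (map (λ p → specht cs (positions (uncurry transposition p ∘ₚ f))) (pairs n))
        ≡⟨ cong sumℤ (map-cong (λ p → cong (specht cs)
             (List.tabulate-cong (position-transposition-∘ (proj₁ p) (proj₂ p) f))) (pairs n)) ⟩
      sumℤ (map (λ p → specht cs (tabulate (position f ∘ uncurry swapFin p))) (pairs n))
        ≡⟨ ∑pairs-swap (position f) (specht cs) ⟩
      ∑swap (positions f) (specht cs)
        ≡⟨ specht-eigen cs (positions f) cs-asc (trans (List.length-tabulate (position f)) (sym size)) ⟩
      contentSum cs * v f ∎

module Frobenius where

  open import Data.Nat using (_+_; _*_; _∸_; _≤_; _>_; z≤n; s≤s)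
  open import Data.Nat.ListAction.Properties using (sum-++; sum-↭)
  open import Data.Nat.Tactic.RingSolver using (solve-∀)
  open import Data.List using (map; replicate; [_])
  open import Data.List.Properties using (length-map; length-replicate)
  import Data.List.Relation.Unary.All as All
  import Data.List.Relation.Unary.All.Properties as All
  import Data.List.Relation.Unary.AllPairs as AllPairs
  import Data.List.Relation.Unary.AllPairs.Properties as AllPairs
  open import Data.List.Relation.Unary.Linked using (Linked; []; [-]; _∷_)
  import Data.List.Relation.Unary.Linked as Linked
  open import Data.Product using (proj₁; proj₂)
  open Specht using (contentSum; contentSum-≡)
  import Data.List.Relation.Binary.Permutation.Propositional.Properties as ↭
  open import Data.List.Relation.Binary.Permutation.Propositional using (_↭_; ↭-sym; ↭⇒↭ₛ)
  open import Data.List.Relation.Binary.Permutation.Setoid.Properties (setoid ℕ) using (Unique-resp-↭)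
  open import Relation.Binary.Properties.DecTotalOrder ℕ.≤-decTotalOrder using (≥-decTotalOrder)
  open import Data.List.Sort ≥-decTotalOrder using (sort; sort-↭; sort-↗)
  open import Function using (_∘_)

  choose2-+ : ∀ a b → choose2 (a + b) ≡ choose2 a + choose2 b + a * b
  choose2-+ zero    b = sym (ℕ.+-identityʳ (choose2 b))
  choose2-+ (suc a) b = trans (cong (_+_ (a + b)) (choose2-+ a b)) (regroup a b (choose2 a) (choose2 b))
    where
    regroup : ∀ a b x y → a + b + (x + y + a * b) ≡ a + x + y + (b + a * b)
    regroup = solve-∀

  sum-map-suc : ∀ cs → sum (map suc cs) ≡ sum cs + length cs
  sum-map-suc []       = refl
  sum-map-suc (c ∷ cs) = trans (cong (_+_ (suc c)) (sum-map-suc cs)) (shift c (sum cs) (length cs))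
    where
    shift : ∀ c s l → suc c + (s + l) ≡ c + s + suc l
    shift = solve-∀

  sum-replicate : ∀ w c → sum (replicate w c) ≡ w * c
  sum-replicate zero    c = refl
  sum-replicate (suc w) c = cong (_+_ c) (sum-replicate w c)

  rowPairs-++ : ∀ cs ds → rowPairs (cs ++ ds) ≡ rowPairs cs + rowPairs ds + sum cs * length ds
  rowPairs-++ []       ds = sym (ℕ.+-identityʳ (rowPairs ds))
  rowPairs-++ (c ∷ cs) ds =
    trans (cong₂ (λ l r → c * l + r) (length-++ cs) (rowPairs-++ cs ds))
          (regroup c (length cs) (length ds) (rowPairs cs) (rowPairs ds) (sum cs))
    where
    regroup : ∀ c l m r r′ s → c * (l + m) + (r + r′ + s * m) ≡ c * l + r + r′ + (c + s) * m
    regroup = solve-∀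

  columnPairs-++ : ∀ cs ds → columnPairs (cs ++ ds) ≡ columnPairs cs + columnPairs ds
  columnPairs-++ []       ds = refl
  columnPairs-++ (c ∷ cs) ds = trans (cong (_+_ (choose2 c)) (columnPairs-++ cs ds)) (sym (ℕ.+-assoc (choose2 c) _ _))

  rowPairs-map-suc : ∀ cs → rowPairs (map suc cs) ≡ rowPairs cs + choose2 (length cs)
  rowPairs-map-suc []       = refl
  rowPairs-map-suc (c ∷ cs) =
    trans (cong₂ (λ l r → suc c * l + r) (length-map suc cs) (rowPairs-map-suc cs))
          (regroup c (length cs) (rowPairs cs) (choose2 (length cs)))
    where
    regroup : ∀ c l r x → suc c * l + (r + x) ≡ c * l + r + (l + x)
    regroup = solve-∀

  columnPairs-map-suc : ∀ cs → columnPairs (map suc cs) ≡ columnPairs cs + sum cs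
  columnPairs-map-suc []       = refl
  columnPairs-map-suc (c ∷ cs) =
    trans (cong (_+_ (c + choose2 c)) (columnPairs-map-suc cs)) (regroup c (choose2 c) (columnPairs cs) (sum cs))
    where
    regroup : ∀ c x p s → c + x + (p + s) ≡ x + p + (c + s)
    regroup = solve-∀

  rowPairs-replicate : ∀ w c → rowPairs (replicate w c) ≡ c * choose2 w
  rowPairs-replicate zero    c = sym (ℕ.*-zeroʳ c)
  rowPairs-replicate (suc w) c =
    trans (cong₂ (λ l r → c * l + r) (length-replicate w) (rowPairs-replicate w c))
          (sym (ℕ.*-distribˡ-+ c w (choose2 w)))

  columnPairs-replicate : ∀ w c → columnPairs (replicate w c) ≡ w * choose2 c
  columnPairs-replicate zero    c = refl
  columnPairs-replicate (suc w) c = cong (_+_ (choose2 c)) (columnPairs-replicate w c)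

  -- Wraps the partition with columns cs in a hook of arm a and leg b: the first row gets
  -- a + 1 cells, the first column b + 1 cells, and every old column grows by one.
  addHook : ℕ → ℕ → List ℕ → List ℕ
  addHook a b cs = replicate (a ∸ length cs) 1 ++ map suc cs ++ [ suc b ]

  module _ (a b : ℕ) (cs : List ℕ) (cs≤a : length cs ≤ a) where

    private
      w = a ∸ length cs
      ℓ = length cs
      s = sum cs
      w+ℓ≡a : w + ℓ ≡ a
      w+ℓ≡a = ℕ.m∸n+n≡m cs≤a

    length-addHook : length (addHook a b cs) ≡ suc a
    length-addHook = begin
      length (replicate w 1 ++ map suc cs ++ [ suc b ])   ≡⟨ length-++ (replicate w 1) ⟩
      length (replicate w 1) + length (map suc cs ++ [ suc b ])
        ≡⟨ cong₂ _+_ (length-replicate w) (trans (length-++ (map suc cs)) (cong (_+ 1) (length-map suc cs))) ⟩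
      w + (ℓ + 1)                                         ≡⟨ cong (_+_ w) (ℕ.+-comm ℓ 1) ⟩
      w + suc ℓ                                           ≡⟨ ℕ.+-suc w ℓ ⟩
      suc (w + ℓ)                                         ≡⟨ cong suc w+ℓ≡a ⟩
      suc a                                               ∎
      where open ≡-Reasoning

    sum-addHook : sum (addHook a b cs) ≡ a + s + suc b
    sum-addHook = begin
      sum (replicate w 1 ++ map suc cs ++ [ suc b ])     ≡⟨ sum-++ (replicate w 1) _ ⟩
      sum (replicate w 1) + sum (map suc cs ++ [ suc b ])
        ≡⟨ cong₂ _+_ (sum-replicate w 1) (sum-++ (map suc cs) [ suc b ]) ⟩
      w * 1 + (sum (map suc cs) + (suc b + 0))          ≡⟨ cong (λ x → w * 1 + (x + (suc b + 0))) (sum-map-suc cs) ⟩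
      w * 1 + (s + ℓ + (suc b + 0))                      ≡⟨ regroup w ℓ s b ⟩
      w + ℓ + s + suc b                                  ≡⟨ cong (λ x → x + s + suc b) w+ℓ≡a ⟩
      a + s + suc b                                      ∎
      where
      open ≡-Reasoning
      regroup : ∀ w ℓ s b → w * 1 + (s + ℓ + (suc b + 0)) ≡ w + ℓ + s + suc b
      regroup = solve-∀

    rowPairs-addHook : rowPairs (addHook a b cs) ≡ rowPairs cs + s + choose2 (suc a)
    rowPairs-addHook = begin
      rowPairs (replicate w 1 ++ map suc cs ++ [ suc b ])
        ≡⟨ rowPairs-++ (replicate w 1) _ ⟩
      rowPairs (replicate w 1) + rowPairs (map suc cs ++ [ suc b ]) + sum (replicate w 1) * length (map suc cs ++ [ suc b ])
        ≡⟨ cong₂ (λ x y → rowPairs (replicate w 1) + x + y) (rowPairs-++ (map suc cs) [ suc b ])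
                 (cong₂ _*_ (sum-replicate w 1) (trans (length-++ (map suc cs)) (cong (_+ 1) (length-map suc cs)))) ⟩
      rowPairs (replicate w 1) + (rowPairs (map suc cs) + (suc b * 0 + 0) + sum (map suc cs) * 1) + w * 1 * (ℓ + 1)
        ≡⟨ cong₃ (rowPairs-replicate w 1) (rowPairs-map-suc cs) (sum-map-suc cs) ⟩
      1 * choose2 w + (rowPairs cs + choose2 ℓ + (suc b * 0 + 0) + (s + ℓ) * 1) + w * 1 * (ℓ + 1)
        ≡⟨ regroup w ℓ s b (rowPairs cs) (choose2 w) (choose2 ℓ) ⟩
      rowPairs cs + s + (w + ℓ + (choose2 w + choose2 ℓ + w * ℓ))
        ≡⟨ cong (λ x → rowPairs cs + s + (w + ℓ + x)) (choose2-+ w ℓ) ⟨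
      rowPairs cs + s + choose2 (suc (w + ℓ))
        ≡⟨ cong (λ x → rowPairs cs + s + choose2 (suc x)) w+ℓ≡a ⟩
      rowPairs cs + s + choose2 (suc a) ∎
      where
      open ≡-Reasoning
      cong₃ : ∀ {x x′ y y′ z z′} → x ≡ x′ → y ≡ y′ → z ≡ z′ →
        x + (y + (suc b * 0 + 0) + z * 1) + w * 1 * (ℓ + 1) ≡ x′ + (y′ + (suc b * 0 + 0) + z′ * 1) + w * 1 * (ℓ + 1)
      cong₃ refl refl refl = refl
      regroup : ∀ w ℓ s b r cw cℓ →
        1 * cw + (r + cℓ + (suc b * 0 + 0) + (s + ℓ) * 1) + w * 1 * (ℓ + 1) ≡ r + s + (w + ℓ + (cw + cℓ + w * ℓ))
      regroup = solve-∀

  columnPairs-addHook : ∀ a b cs → columnPairs (addHook a b cs) ≡ columnPairs cs + sum cs + choose2 (suc b)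
  columnPairs-addHook a b cs = begin
    columnPairs (replicate w 1 ++ map suc cs ++ [ suc b ])
      ≡⟨ columnPairs-++ (replicate w 1) _ ⟩
    columnPairs (replicate w 1) + columnPairs (map suc cs ++ [ suc b ])
      ≡⟨ cong₂ _+_ (columnPairs-replicate w 1) (columnPairs-++ (map suc cs) [ suc b ]) ⟩
    w * 0 + (columnPairs (map suc cs) + (choose2 (suc b) + 0))
      ≡⟨ cong (λ x → w * 0 + (x + (choose2 (suc b) + 0))) (columnPairs-map-suc cs) ⟩
    w * 0 + (columnPairs cs + sum cs + (choose2 (suc b) + 0))
      ≡⟨ regroup w (columnPairs cs) (sum cs) (choose2 (suc b)) ⟩
    columnPairs cs + sum cs + choose2 (suc b) ∎
    where
    open ≡-Reasoning
    w = a ∸ length cs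
    regroup : ∀ w p s c → w * 0 + (p + s + (c + 0)) ≡ p + s + c
    regroup = solve-∀

  AllPairs-replicate : ∀ {R : ℕ → ℕ → Set} {x} w → R x x → AllPairs R (replicate w x)
  AllPairs-replicate zero    Rxx = []
  AllPairs-replicate (suc w) Rxx = All.replicate⁺ w Rxx ∷ AllPairs-replicate w Rxx

  addHook-ascending : ∀ a b cs → AllPairs _≤_ cs → All (_≤ b) cs → AllPairs _≤_ (addHook a b cs)
  addHook-ascending a b cs cs-asc cs≤b = AllPairs.++⁺
    (AllPairs-replicate (a ∸ length cs) ℕ.≤-refl)
    (AllPairs.++⁺ (AllPairs.map⁺ (AllPairs.map s≤s cs-asc)) ([] ∷ [])
                  (All.map⁺ (All.map (λ c≤b → s≤s c≤b ∷ []) cs≤b)))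
    (All.replicate⁺ (a ∸ length cs) (All.++⁺ (All.map⁺ (All.universal (λ _ → s≤s z≤n) cs)) (s≤s z≤n ∷ [])))

  addHook-bounded : ∀ a b cs → All (_≤ b) cs → All (_≤ suc b) (addHook a b cs)
  addHook-bounded a b cs cs≤b = All.++⁺ (All.replicate⁺ (a ∸ length cs) (s≤s z≤n))
    (All.++⁺ (All.map⁺ (All.map s≤s cs≤b)) (ℕ.≤-refl ∷ []))

  frobenius : List ℕ → List ℕ → List ℕ
  frobenius (a ∷ α) (b ∷ β) = addHook a b (frobenius α β)
  frobenius _       _       = []

  frobenius-fits : ∀ {a b} α β → Linked _>_ (a ∷ α) → Linked _>_ (b ∷ β) →
    length (frobenius α β) ≤ a × All (_≤ b) (frobenius α β)
  frobenius-fits []       _        _               _               = z≤n , []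
  frobenius-fits (_ ∷ _)  []       _               _               = z≤n , []
  frobenius-fits (a′ ∷ α) (b′ ∷ β) (a′<a ∷ α-desc) (b′<b ∷ β-desc) =
    ℕ.≤-trans (ℕ.≤-reflexive (length-addHook a′ b′ (frobenius α β) α-fits)) a′<a ,
    All.map (λ c≤ → ℕ.≤-trans c≤ b′<b) (addHook-bounded a′ b′ (frobenius α β) β-fits)
    where
    α-fits = proj₁ (frobenius-fits α β α-desc β-desc)
    β-fits = proj₂ (frobenius-fits α β α-desc β-desc)

  frobenius-ascending : ∀ α β → Linked _>_ α → Linked _>_ β → AllPairs _≤_ (frobenius α β)
  frobenius-ascending []      _       _      _      = []
  frobenius-ascending (_ ∷ _) []      _      _      = []
  frobenius-ascending (a ∷ α) (b ∷ β) α-desc β-desc = addHook-ascending a b (frobenius α β)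
    (frobenius-ascending α β (Linked.tail α-desc) (Linked.tail β-desc)) (proj₂ (frobenius-fits α β α-desc β-desc))

  frobenius-size : ∀ α β → Linked _>_ α → Linked _>_ β → length α ≡ length β →
    sum (frobenius α β) ≡ sum α + sum β + length α
  frobenius-size []      []      _      _      _   = refl
  frobenius-size (a ∷ α) (b ∷ β) α-desc β-desc len = begin
    sum (addHook a b (frobenius α β))
      ≡⟨ sum-addHook a b (frobenius α β) (proj₁ (frobenius-fits α β α-desc β-desc)) ⟩
    a + sum (frobenius α β) + suc b
      ≡⟨ cong (λ x → a + x + suc b)
              (frobenius-size α β (Linked.tail α-desc) (Linked.tail β-desc) (ℕ.suc-injective len)) ⟩
    a + (sum α + sum β + length α) + suc b
      ≡⟨ regroup a b (sum α) (sum β) (length α) ⟩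
    a + sum α + (b + sum β) + suc (length α) ∎
    where
    open ≡-Reasoning
    regroup : ∀ a b x y l → a + (x + y + l) + suc b ≡ a + x + (b + y) + suc l
    regroup = solve-∀

  triangle : ℕ → ℕ
  triangle a = choose2 (suc a)

  frobenius-content : ∀ α β → Linked _>_ α → Linked _>_ β → length α ≡ length β →
    rowPairs (frobenius α β) + sum (map triangle β) ≡ columnPairs (frobenius α β) + sum (map triangle α)
  frobenius-content []      []      _      _      _   = refl
  frobenius-content (a ∷ α) (b ∷ β) α-desc β-desc len = begin
    rowPairs (addHook a b cs) + (triangle b + sum (map triangle β))
      ≡⟨ cong (_+ (triangle b + sum (map triangle β)))
              (rowPairs-addHook a b cs (proj₁ (frobenius-fits α β α-desc β-desc))) ⟩
    rowPairs cs + sum cs + triangle a + (triangle b + sum (map triangle β))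
      ≡⟨ regroup (rowPairs cs) (sum cs) (triangle a) (triangle b) (sum (map triangle β)) ⟩
    rowPairs cs + sum (map triangle β) + sum cs + triangle a + triangle b
      ≡⟨ cong (λ x → x + sum cs + triangle a + triangle b)
              (frobenius-content α β (Linked.tail α-desc) (Linked.tail β-desc) (ℕ.suc-injective len)) ⟩
    columnPairs cs + sum (map triangle α) + sum cs + triangle a + triangle b
      ≡⟨ regroup′ (columnPairs cs) (sum cs) (triangle a) (triangle b) (sum (map triangle α)) ⟩
    columnPairs cs + sum cs + triangle b + (triangle a + sum (map triangle α))
      ≡⟨ cong (_+ (triangle a + sum (map triangle α))) (columnPairs-addHook a b cs) ⟨
    columnPairs (addHook a b cs) + (triangle a + sum (map triangle α)) ∎
    where
    open ≡-Reasoning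
    cs = frobenius α β
    regroup : ∀ r s ta tb tβ → r + s + ta + (tb + tβ) ≡ r + tβ + s + ta + tb
    regroup = solve-∀
    regroup′ : ∀ c s ta tb tα → c + tα + s + ta + tb ≡ c + s + tb + (ta + tα)
    regroup′ = solve-∀

  sort-strictly-descending : ∀ α → Unique α → Linked _>_ (sort α)
  sort-strictly-descending α α-unique =
    strictly (sort-↗ α) (Unique-resp-↭ (↭⇒↭ₛ (↭-sym (sort-↭ α))) α-unique)
    where
    strictly : ∀ {xs} → Linked (λ x y → y ≤ x) xs → Unique xs → Linked _>_ xs
    strictly []            _                 = []
    strictly [-]           _                 = [-]
    strictly (y≤x ∷ sorted) ((x≢y ∷ _) ∷ xs-unique) =
      ℕ.≤∧≢⇒< y≤x (x≢y ∘ sym) ∷ strictly sorted xs-unique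

  record FrobeniusCoordinates (n m : ℕ) : Set where
    field
      arms legs   : List ℕ
      arms-unique : Unique arms
      legs-unique : Unique legs
      same-length : length arms ≡ length legs
      size        : sum arms + sum legs + length arms ≡ n
      content     : sum (map triangle arms) ≡ sum (map triangle legs) + m

  partition-from-frobenius : ∀ {n m} → FrobeniusCoordinates n m →
    ∃[ cs ] AllPairs _≤_ cs × sum cs ≡ n × contentSum cs ≡ + m
  partition-from-frobenius {n} {m} F =
    cs , frobenius-ascending α β α-desc β-desc , cs-size ,
    contentSum-≡ cs m (ℕ.+-cancelʳ-≡ (sum (map triangle β)) _ _ rows)
    where
    open FrobeniusCoordinates F
    open ≡-Reasoning
    α = sort arms
    β = sort legs
    cs = frobenius α β
    α-desc = sort-strictly-descending arms arms-unique
    β-desc = sort-strictly-descending legs legs-unique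
    length-≡ : length α ≡ length β
    length-≡ = trans (↭.↭-length (sort-↭ arms)) (trans same-length (sym (↭.↭-length (sort-↭ legs))))
    triangles-↭ : ∀ {xs ys} → xs ↭ ys → sum (map triangle xs) ≡ sum (map triangle ys)
    triangles-↭ xs↭ys = sum-↭ (↭.map⁺ triangle xs↭ys)
    cs-size : sum cs ≡ n
    cs-size = begin
      sum cs                          ≡⟨ frobenius-size α β α-desc β-desc length-≡ ⟩
      sum α + sum β + length α
        ≡⟨ cong₂ _+_ (cong₂ _+_ (sum-↭ (sort-↭ arms)) (sum-↭ (sort-↭ legs))) (↭.↭-length (sort-↭ arms)) ⟩
      sum arms + sum legs + length arms ≡⟨ size ⟩
      n                               ∎
    rows : rowPairs cs + sum (map triangle β) ≡ columnPairs cs + m + sum (map triangle β)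
    rows = begin
      rowPairs cs + sum (map triangle β)            ≡⟨ frobenius-content α β α-desc β-desc length-≡ ⟩
      columnPairs cs + sum (map triangle α)         ≡⟨ cong (_+_ (columnPairs cs)) (triangles-↭ (sort-↭ arms)) ⟩
      columnPairs cs + sum (map triangle arms)      ≡⟨ cong (_+_ (columnPairs cs)) content ⟩
      columnPairs cs + (sum (map triangle legs) + m) ≡⟨ cong (λ x → columnPairs cs + (x + m)) (triangles-↭ (sort-↭ legs)) ⟨
      columnPairs cs + (sum (map triangle β) + m)    ≡⟨ regroup (columnPairs cs) (sum (map triangle β)) m ⟩
      columnPairs cs + m + sum (map triangle β)      ∎
      where
      regroup : ∀ c t m → c + (t + m) ≡ c + m + t
      regroup = solve-∀

module Realisation where

  open import Data.Nat using (_+_; _*_; _≟_)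
  open import Data.Nat.Tactic.RingSolver using (solve-∀)
  open import Relation.Binary.PropositionalEquality using (≢-sym)
  open Frobenius

  -- With a = k + d + 2: targetValue k d = C(a,2) − k and targetSize k d t = 3a + 16 + 2t.
  targetValue : ℕ → ℕ → ℕ
  targetValue k d = k + d + d + 1 + choose2 (k + d)

  targetSize : ℕ → ℕ → ℕ → ℕ
  targetSize k d t = 3 * (k + d + 2) + 16 + 2 * t

  ≢-by-gap : ∀ {x y} e → y ≡ x + suc e → x ≢ y
  ≢-by-gap {x} e y≡x+1+e x≡y = ℕ.m+1+n≢m x (sym (trans x≡y y≡x+1+e))

  unique₂ : ∀ {x y : ℕ} → x ≢ y → Unique (x ∷ y ∷ [])
  unique₂ x≢y = (x≢y ∷ []) ∷ [] ∷ []

  unique₃ : ∀ {x y z : ℕ} → x ≢ y → x ≢ z → y ≢ z → Unique (x ∷ y ∷ z ∷ [])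
  unique₃ x≢y x≢z y≢z = (x≢y ∷ x≢z ∷ []) ∷ (y≢z ∷ []) ∷ [] ∷ []

  coordinates-k≡1 : ∀ d t → FrobeniusCoordinates (targetSize 1 d t) (targetValue 1 d)
  coordinates-k≡1 d t = record
    { arms        = 2 + d ∷ 10 + d + t ∷ []
    ; legs        = 1 ∷ 10 + d + t ∷ []
    ; arms-unique = unique₂ (≢-by-gap (7 + t) (gap d t))
    ; legs-unique = unique₂ (λ ())
    ; same-length = refl
    ; size        = size d t
    ; content     = content (triangle (10 + d + t)) (choose2 (1 + d)) d
    }
    where
    gap : ∀ d t → 10 + d + t ≡ 2 + d + suc (7 + t)
    gap = solve-∀
    size : ∀ d t → 2 + d + (10 + d + t + 0) + (1 + (10 + d + t + 0)) + 2 ≡ 3 * (1 + d + 2) + 16 + 2 * t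
    size = solve-∀
    content : ∀ X c d → (2 + d) + ((1 + d) + c) + (X + 0) ≡ 1 + (X + 0) + (1 + d + d + 1 + c)
    content = solve-∀

  coordinates-3+j : ∀ j i d t → j + i ≡ 5 → FrobeniusCoordinates (targetSize (3 + j) d t) (targetValue (3 + j) d)
  coordinates-3+j j i d t j+i≡5 = record
    { arms        = 4 + j + d ∷ 1 + j ∷ 10 + d + t ∷ []
    ; legs        = 1 ∷ 2 + j ∷ 10 + d + t ∷ []
    ; arms-unique = unique₃ (≢-sym (≢-by-gap (2 + d) (gap₁ j d)))
                            (≢-by-gap (i + t) (using-j+i (gap₂ j i d t)))
                            (≢-by-gap (3 + i + d + t) (using-j+i (gap₃ j i d t)))
    ; legs-unique = unique₃ (λ ()) (λ ()) (≢-by-gap (2 + i + d + t) (using-j+i (gap₄ j i d t)))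
    ; same-length = refl
    ; size        = size j d t
    ; content     = content (triangle (10 + d + t)) (choose2 (1 + j)) (choose2 (3 + j + d)) j d
    }
    where
    using-j+i : ∀ {x y} → 5 + (j + i) + x ≡ y → 10 + x ≡ y
    using-j+i {x} = trans (cong (λ u → 5 + u + x) (sym j+i≡5))
    gap₁ : ∀ j d → 4 + j + d ≡ 1 + j + suc (2 + d)
    gap₁ = solve-∀
    gap₂ : ∀ j i d t → 5 + (j + i) + (d + t) ≡ 4 + j + d + suc (i + t)
    gap₂ = solve-∀
    gap₃ : ∀ j i d t → 5 + (j + i) + (d + t) ≡ 1 + j + suc (3 + i + d + t)
    gap₃ = solve-∀
    gap₄ : ∀ j i d t → 5 + (j + i) + (d + t) ≡ 2 + j + suc (2 + i + d + t)
    gap₄ = solve-∀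
    size : ∀ j d t → 4 + j + d + (1 + j + (10 + d + t + 0)) + (1 + (2 + j + (10 + d + t + 0))) + 3
                     ≡ 3 * (3 + j + d + 2) + 16 + 2 * t
    size = solve-∀
    content : ∀ X c e j d → (4 + j + d) + ((3 + j + d) + e) + (1 + j + c + (X + 0))
                            ≡ 1 + (2 + j + (1 + j + c) + (X + 0)) + (3 + j + d + d + 1 + e)
    content = solve-∀

  coordinates-A : ∀ k d t → k ≢ 4 → d ≢ 1 + k + t → d ≢ 2 + k + t → d ≢ 5 + t →
    FrobeniusCoordinates (targetSize k d t) (targetValue k d)
  coordinates-A k d t k≢4 d≢1+k+t d≢2+k+t d≢5+t = record
    { arms        = 5 + k + t ∷ 4 + d ∷ k + d ∷ []
    ; legs        = 2 ∷ 5 + k + t ∷ 3 + d ∷ []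
    ; arms-unique = unique₃ (λ eq → d≢1+k+t (sym (ℕ.+-cancelˡ-≡ 4 (1 + k + t) d eq)))
                            (λ eq → d≢5+t (sym (ℕ.+-cancelˡ-≡ k (5 + t) d (trans (shift k t) eq))))
                            (λ eq → k≢4 (sym (ℕ.+-cancelʳ-≡ d 4 k eq)))
    ; legs-unique = unique₃ (λ ()) (λ ()) (λ eq → d≢2+k+t (sym (ℕ.+-cancelˡ-≡ 3 (2 + k + t) d eq)))
    ; same-length = refl
    ; size        = size k d t
    ; content     = content (triangle (5 + k + t)) (choose2 (4 + d)) d k (choose2 (k + d))
    }
    where
    shift : ∀ k t → k + (5 + t) ≡ 5 + k + t
    shift = solve-∀
    size : ∀ k d t → 5 + k + t + (4 + d + (k + d + 0)) + (2 + (5 + k + t + (3 + d + 0))) + 3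
                     ≡ 3 * (k + d + 2) + 16 + 2 * t
    size = solve-∀
    content : ∀ X c d k e → X + (4 + d + c + (k + d + e + 0)) ≡ 3 + (X + (c + 0)) + (k + d + d + 1 + e)
    content = solve-∀

  coordinates-B : ∀ k d t → k ≢ 1 → d ≢ 0 → d ≢ 8 + k + t → d ≢ 9 + k + t → d ≢ 9 + t →
    FrobeniusCoordinates (targetSize k d t) (targetValue k d)
  coordinates-B k d t k≢1 d≢0 d≢8+k+t d≢9+k+t d≢9+t = record
    { arms        = 9 + k + t ∷ 1 + d ∷ k + d ∷ []
    ; legs        = 0 ∷ 9 + k + t ∷ d ∷ []
    ; arms-unique = unique₃ (λ eq → d≢8+k+t (sym (ℕ.suc-injective eq)))
                            (λ eq → d≢9+t (sym (ℕ.+-cancelˡ-≡ k (9 + t) d (trans (shift k t) eq))))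
                            (λ eq → k≢1 (sym (ℕ.+-cancelʳ-≡ d 1 k eq)))
    ; legs-unique = unique₃ (λ ()) (≢-sym d≢0) (≢-sym d≢9+k+t)
    ; same-length = refl
    ; size        = size k d t
    ; content     = content (triangle (9 + k + t)) (choose2 (1 + d)) d k (choose2 (k + d))
    }
    where
    shift : ∀ k t → k + (9 + t) ≡ 9 + k + t
    shift = solve-∀
    size : ∀ k d t → 9 + k + t + (1 + d + (k + d + 0)) + (0 + (9 + k + t + (d + 0))) + 3
                     ≡ 3 * (k + d + 2) + 16 + 2 * t
    size = solve-∀
    content : ∀ X c d k e → X + (1 + d + c + (k + d + e + 0)) ≡ 0 + (X + (c + 0)) + (k + d + d + 1 + e)
    content = solve-∀

  coordinates-generic : ∀ k d t → k ≢ 1 → k ≢ 4 → k ≢ 7 → k ≢ 8 →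
    FrobeniusCoordinates (targetSize k d t) (targetValue k d)
  coordinates-generic k d t k≢1 k≢4 k≢7 k≢8 with d ≟ 1 + k + t | d ≟ 2 + k + t | d ≟ 5 + t
  ... | yes refl | _ | _ = coordinates-B k _ t k≢1 (λ ()) (ℕ.m≢1+n+m (1 + k + t) {6}) (ℕ.m≢1+n+m (1 + k + t) {7})
        (λ eq → k≢8 (ℕ.suc-injective (ℕ.+-cancelʳ-≡ t (1 + k) 9 eq)))
  ... | no _ | yes refl | _ = coordinates-B k _ t k≢1 (λ ()) (ℕ.m≢1+n+m (2 + k + t) {5}) (ℕ.m≢1+n+m (2 + k + t) {6})
        (λ eq → k≢7 (ℕ.suc-injective (ℕ.suc-injective (ℕ.+-cancelʳ-≡ t (2 + k) 9 eq))))
  ... | no _ | no _ | yes refl = coordinates-B k _ t k≢1 (λ ())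
        (≢-by-gap (2 + k) (gap₁ k t)) (≢-by-gap (3 + k) (gap₂ k t)) (ℕ.m≢1+n+m (5 + t) {3})
    where
    gap₁ : ∀ k t → 8 + k + t ≡ 5 + t + suc (2 + k)
    gap₁ = solve-∀
    gap₂ : ∀ k t → 9 + k + t ≡ 5 + t + suc (3 + k)
    gap₂ = solve-∀
  ... | no d≢1+k+t | no d≢2+k+t | no d≢5+t = coordinates-A k d t k≢4 d≢1+k+t d≢2+k+t d≢5+t

  -- Each family contains a hook with equal arm and leg; it adds no content and absorbs t.
  coordinates : ∀ k d t → FrobeniusCoordinates (targetSize k d t) (targetValue k d)
  coordinates k d t with k ≟ 1 | k ≟ 4 | k ≟ 7 | k ≟ 8
  ... | yes refl | _        | _        | _        = coordinates-k≡1 d t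
  ... | no _     | yes refl | _        | _        = coordinates-3+j 1 4 d t refl
  ... | no _     | no _     | yes refl | _        = coordinates-3+j 4 1 d t refl
  ... | no _     | no _     | no _     | yes refl = coordinates-3+j 5 0 d t refl
  ... | no k≢1   | no k≢4   | no k≢7   | no k≢8   = coordinates-generic k d t k≢1 k≢4 k≢7 k≢8

module Parameters where

  open import Data.Nat using (_+_; _*_; _∸_; _≤_; _<_; _/_; _%_; s≤s)
  open import Data.Nat.Combinatorics using (_C_; nC1≡n; nCk+nC[k+1]≡[n+1]C[k+1])
  import Data.Nat.DivMod as ℕ
  open import Data.Nat.Tactic.RingSolver using (solve-∀)
  open Realisation using (targetValue; targetSize)

  C2≡choose2 : ∀ n → n C 2 ≡ choose2 n
  C2≡choose2 zero    = refl
  C2≡choose2 (suc n) = trans (sym (nCk+nC[k+1]≡[n+1]C[k+1] n 1)) (cong₂ _+_ (nC1≡n n) (C2≡choose2 n))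

  value-parameters : ∀ a m → 2 ≤ a → (a ∸ 1) C 2 + 1 ≤ m → m ≤ a C 2 →
    ∃[ k ] ∃[ d ] k + d + 2 ≡ a × m ≡ targetValue k d
  value-parameters zero          m ()              lower upper
  value-parameters (suc zero)    m (s≤s ())        lower upper
  value-parameters (suc (suc b)) m _ lower upper = k , d , k+d+2≡a , ℕ.+-cancelʳ-≡ k m (targetValue k d) (begin-equality
      m + k                              ≡⟨ m+k≡ ⟩
      choose2 (suc (suc b))               ≡⟨ cong (λ x → choose2 (suc (suc x))) k+d≡b ⟨
      choose2 (suc (suc (k + d)))         ≡⟨ regroup k d (choose2 (k + d)) ⟩
      targetValue k d + k                ∎)
    where
    open ℕ.≤-Reasoning
    upper′ : m ≤ choose2 (suc (suc b))
    upper′ = subst (m ≤_) (C2≡choose2 (suc (suc b))) upper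
    k = proj₁ (ℕ.m≤n⇒∃[o]m+o≡n upper′)
    m+k≡ = proj₂ (ℕ.m≤n⇒∃[o]m+o≡n upper′)
    k≤b : k ≤ b
    k≤b = ℕ.+-cancelˡ-≤ (choose2 (suc b) + 1) k b (begin
      choose2 (suc b) + 1 + k ≤⟨ ℕ.+-monoˡ-≤ k (subst (λ x → x + 1 ≤ m) (C2≡choose2 (suc b)) lower) ⟩
      m + k                   ≡⟨ m+k≡ ⟩
      choose2 (suc (suc b))   ≡⟨ bound b (choose2 b) ⟩
      choose2 (suc b) + 1 + b ∎)
      where
      bound : ∀ b c → suc b + (b + c) ≡ b + c + 1 + b
      bound = solve-∀
    d = proj₁ (ℕ.m≤n⇒∃[o]m+o≡n k≤b)
    k+d≡b = proj₂ (ℕ.m≤n⇒∃[o]m+o≡n k≤b)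
    k+d+2≡a : k + d + 2 ≡ suc (suc b)
    k+d+2≡a = trans (ℕ.+-comm (k + d) 2) (cong (λ x → suc (suc x)) k+d≡b)
    regroup : ∀ k d c → suc (k + d) + (k + d + c) ≡ k + d + d + 1 + c + k
    regroup = solve-∀

  size-parameters : ∀ n a → 27 ≤ n → a ≤ (n ∸ 15) / 3 → (n ∸ a) % 2 ≡ 0 → ∃[ t ] n ≡ 3 * a + 16 + 2 * t
  size-parameters n a 27≤n a≤[n-15]/3 n-a-even = t , (begin-equality
      n                            ≡⟨ n≡a+q*2 ⟩
      a + q * 2                    ≡⟨ cong (λ x → a + x * 2) q≡ ⟨
      a + (suc (a + 7) + t) * 2    ≡⟨ regroup a t ⟩
      3 * a + 16 + 2 * t           ∎)
    where
    open ℕ.≤-Reasoning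
    q = (n ∸ a) / 2
    3a+15≤n : a * 3 + 15 ≤ n
    3a+15≤n = begin
      a * 3 + 15
        ≤⟨ ℕ.+-monoˡ-≤ 15 (ℕ.≤-trans (ℕ.*-monoˡ-≤ 3 a≤[n-15]/3) (ℕ.m/n*n≤m (n ∸ 15) 3)) ⟩
      n ∸ 15 + 15            ≡⟨ ℕ.m∸n+n≡m (ℕ.≤-trans (ℕ.m≤m+n 15 12) 27≤n) ⟩
      n                      ∎
    n≡a+q*2 : n ≡ a + q * 2
    n≡a+q*2 = begin-equality
      n
        ≡⟨ ℕ.m+[n∸m]≡n (ℕ.≤-trans (ℕ.m≤m*n a 3) (ℕ.≤-trans (ℕ.m≤m+n (a * 3) 15) 3a+15≤n)) ⟨
      a + (n ∸ a)               ≡⟨ cong (_+_ a) (ℕ.m≡m%n+[m/n]*n (n ∸ a) 2) ⟩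
      a + ((n ∸ a) % 2 + q * 2) ≡⟨ cong (λ r → a + (r + q * 2)) n-a-even ⟩
      a + q * 2                 ∎
    a+7<q : a + 7 < q
    a+7<q = ℕ.*-cancelˡ-< 2 (a + 7) q (ℕ.+-cancelˡ-≤ a _ _ (begin
      a + suc (2 * (a + 7))  ≡⟨ bound a ⟩
      a * 3 + 15             ≤⟨ 3a+15≤n ⟩
      n                      ≡⟨ n≡a+q*2 ⟩
      a + q * 2              ≡⟨ cong (_+_ a) (ℕ.*-comm q 2) ⟩
      a + 2 * q              ∎))
      where
      bound : ∀ a → a + suc (2 * (a + 7)) ≡ a * 3 + 15
      bound = solve-∀
    t = proj₁ (ℕ.m≤n⇒∃[o]m+o≡n a+7<q)
    q≡ = proj₂ (ℕ.m≤n⇒∃[o]m+o≡n a+7<q)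
    regroup : ∀ a t → a + (suc (a + 7) + t) * 2 ≡ 3 * a + 16 + 2 * t
    regroup = solve-∀

open import Data.Nat using (_+_; _*_; _∸_; _≤_; _/_; _%_)
open import Data.Nat.Combinatorics using (_C_)
open import Relation.Binary.PropositionalEquality using (subst₂)
open CayleyGraph using (contentSum-isEigenvalue)
open Frobenius using (partition-from-frobenius)
open Realisation using (coordinates; targetSize)
open Parameters using (value-parameters; size-parameters)

theorem3p2 : (n : ℕ) → 27 ≤ n → (a : ℕ) → 3 ≤ a → a ≤ (n ∸ 15) / 3 → (n ∸ a) % 2 ≡ 0 →
    (m : ℕ) → ((a ∸ 1) C 2) + 1 ≤ m → m ≤ a C 2 → IsEigenvalue n (+ m)
theorem3p2 n 27≤n a 3≤a a≤[n-15]/3 n-a-even m lower upper =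
  let (k , d , k+d+2≡a , m≡value)       = value-parameters a m (ℕ.<⇒≤ 3≤a) lower upper
      (t , n≡size)                      = size-parameters n a 27≤n a≤[n-15]/3 n-a-even
      (cs , ascending , size , content) = partition-from-frobenius (coordinates k d t)
  in subst₂ IsEigenvalue (trans (cong (λ x → 3 * x + 16 + 2 * t) k+d+2≡a) (sym n≡size))
                         (trans content (cong +_ (sym m≡value)))
                         (contentSum-isEigenvalue (targetSize k d t) cs ascending size)
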